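{- For all $n\ge1$: (a) $G^{\mathrm{I}}_{2n,1}=G^{\mathrm{I}}_{2n,2}$; (b) $2G^{\mathrm{I}}_{2n,2n-1}=\sum_{i=1}^{2n}G^{\mathrm{I}}_{2n,i}$; (c) $G^{\mathrm{I}}_{2n,2k}=S_{2n,n+1-k}$ for every $1\le k\le n$. Moreover, for all $n\ge2$: (d) $G^{\mathrm{I}}_{2n,3}=2\left(G^{\mathrm{I}}_{2n,1}+G^{\mathrm{I}}_{2n-2,1}\right)$; (e) $G^{\mathrm{I}}_{2n,2n}=\sum_{i=1}^{2n-2}G^{\mathrm{I}}_{2n-2,i}=G^{\mathrm{I}}_{2n-2}$.
   Context: For $n\ge1$, $\mathfrak{G}^{\mathrm{I}}_{2n}$ is the set of permutations $\pi=\pi_1\cdots\pi_{2n}$ of $[2n]$ such that every ascent $\pi_i<\pi_{i+1}$ has $\pi_i$ odd and $\pi_{i+1}$ even. Let $G^{\mathrm{I}}_{2n}=|\mathfrak{G}^{\mathrm{I}}_{2n}|$, and for $1\le k\le 2n$ let $G^{\mathrm{I}}_{2n,k}$ be the number of $\pi\in\mathfrak{G}^{\mathrm{I}}_{2n}$ with $\pi_1=k$; set $G^{\mathrm{I}}_{2n,k}=0$ for $k<1$ or $k>2n$. The Seidel triangle $(S_{n,k})$ is defined by $S_{1,1}=1$, $S_{n,k}=0$ if $k\notin[1,\lceil n/2\rceil]$, and for $n\ge1$: $S_{2n,k}=S_{2n-1,k}+S_{2n,k+1}$ and $S_{2n+1,k}=S_{2n,k}+S_{2n+1,k-1}$. 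-}

module Defs where

open import Data.Nat using (ℕ; zero; suc; _+_; _*_; _∸_; _/_; _%_; _≤ᵇ_; _≡ᵇ_)
open import Data.Bool using (Bool; true; false; _∧_; _∨_; not; if_then_else_)
open import Data.List using (List; []; _∷_; map; concatMap; filterᵇ; length; upTo)
open import Data.Nat.ListAction using (sum)

insertions : ℕ → List ℕ → List (List ℕ)
insertions x []       = (x ∷ []) ∷ []
insertions x (y ∷ ys) = (x ∷ y ∷ ys) ∷ map (y ∷_) (insertions x ys)

perms : ℕ → List (List ℕ)
perms zero    = [] ∷ []
perms (suc m) = concatMap (insertions (suc m)) (perms m)

odd? : ℕ → Bool
odd? n = n % 2 ≡ᵇ 1

even? : ℕ → Bool
even? n = n % 2 ≡ᵇ 0

_<ᵇ_ : ℕ → ℕ → Bool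
a <ᵇ b = suc a ≤ᵇ b

ascentsOK : List ℕ → Bool
ascentsOK []           = true
ascentsOK (a ∷ [])     = true
ascentsOK (a ∷ b ∷ xs) =
  (not (a <ᵇ b) ∨ (odd? a ∧ even? b)) ∧ ascentsOK (b ∷ xs)

firstIs : ℕ → List ℕ → Bool
firstIs k []      = false
firstIs k (a ∷ _) = a ≡ᵇ k

GI : ℕ → ℕ
GI m = length (filterᵇ ascentsOK (perms m))

-- GIk m k = number of π ∈ 𝔊ᴵ_m with π₁ = k  (automatically 0 for k ∉ [1,m])
GIk : ℕ → ℕ → ℕ
GIk m k = length (filterᵇ (λ π → ascentsOK π ∧ firstIs k π) (perms m))

sum1to : ℕ → (ℕ → ℕ) → ℕ
sum1to m f = sum (map (λ i → f (suc i)) (upTo m))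

-- E r k = S_{2r,k} (r ≥ 1; E 0 k = 0),  O r k = S_{2r+1,k}.
-- S_{n,k} = 0 for k ∉ [1, ⌈n/2⌉]; inside that range:
--   S_{2r,k}   = S_{2r-1,k} + S_{2r,k+1}    (computed by EAcc, k going up)
--   S_{2r+1,k} = S_{2r,k}   + S_{2r+1,k-1}  (computed by OAcc, k going down)

mutual
  E : ℕ → ℕ → ℕ
  E zero    k = 0
  E (suc r) k = if (1 ≤ᵇ k) ∧ (k ≤ᵇ suc r) then EAcc (suc r) k (suc (suc r) ∸ k) else 0

  -- EAcc (r+1) k d = S_{2r+2,k} when d = (r+2) - k  (d = 0 ⇔ k = r+2, out of range)
  EAcc : ℕ → ℕ → ℕ → ℕ
  EAcc zero    k d       = 0
  EAcc (suc r) k zero    = 0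
  EAcc (suc r) k (suc d) = O r k + EAcc (suc r) (suc k) d

  O : ℕ → ℕ → ℕ
  O zero    k = if k ≡ᵇ 1 then 1 else 0
  O (suc r) k = if k ≤ᵇ suc (suc r) then OAcc (suc r) k else 0

  -- OAcc (r+1) k = S_{2r+3,k} for k ≤ r+2  (OAcc _ 0 = S_{2r+3,0} = 0)
  OAcc : ℕ → ℕ → ℕ
  OAcc r zero    = 0
  OAcc r (suc k) = E r (suc k) + OAcc r k

-- S n k = S_{n,k} (S 0 k = 0, row 0 is not part of the triangle)
S : ℕ → ℕ → ℕ
S n k = if n % 2 ≡ᵇ 0 then E (n / 2) k else O (n / 2) k

-- A word is built letter by letter, and whether the next letter may follow the current
-- one depends only on the two parities and on which letter is larger.  So the number of
-- valid words with a given first letter depends only on the parity words of the letters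
-- above and below it, and satisfies a recursion over the choice of the second letter.
-- For the letters 1, …, 2n these parity words alternate, and a few local identities of
-- that recursion (a largest odd letter can never be reached, a smallest even letter must
-- come last, an even letter directly above an odd one acts like a single letter, and the
-- two parity patterns of a pair of adjacent letters are related through the counts with
-- that pair merged or removed) yield (a), (b), (d) and (e) directly, and show that
-- G_{2n,2k} satisfies the recurrence of the Seidel triangle, which gives (c).
module Submission where

open import Defs
open import Data.Bool using (Bool; true; false; not; _∧_; _∨_; T)
open import Data.Bool.Properties using (T-≡; ∧-zeroʳ; ∧-identityʳ; if-cong)
open import Data.List
  using (List; []; _∷_; _++_; map; length; concatMap; filterᵇ; applyDownFrom; applyUpTo; reverse)
open import Data.List.Properties
  using (++-assoc; ++-identityʳ; length-++; map-++; map-cong; map-∘; reverse-applyUpTo; reverse-map; map-applyUpTo;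
         map-upTo; length-applyDownFrom)
open import Data.List.Relation.Binary.Permutation.Propositional.Properties using (↭-reverse)
import Data.List.Relation.Unary.All as All
import Data.List.Relation.Unary.All.Properties as All
open import Data.List.Relation.Unary.AllPairs using (AllPairs; []; _∷_)
import Data.List.Relation.Unary.AllPairs as AllPairs
open import Data.List.Relation.Unary.AllPairs.Properties using (applyDownFrom⁺₁)
open import Data.List.Relation.Unary.Unique.Propositional using (Unique)
open import Data.Nat
  using (ℕ; zero; suc; _+_; _*_; _∸_; _≤_; _<_; _>_; s≤s; s<s; s<s⁻¹; z<s; _≡ᵇ_; _%_; _/_)
open import Data.Nat.DivMod using (m*n%n≡0; m*n/n≡m)
open import Data.Nat.ListAction using (sum)
open import Data.Nat.ListAction.Properties using (sum-++; sum-↭)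
open import Data.Nat.Properties
open import Algebra.Properties.CommutativeSemigroup +-commutativeSemigroup using (interchange)
open import Data.Nat.Tactic.RingSolver using (solve-∀)
open import Data.Product using (_×_; _,_; proj₁; proj₂)
open import Data.Unit using (tt)
open import Function using (_∘_)
open import Function.Bundles using (Equivalence)
open import Relation.Binary.PropositionalEquality
  using (_≡_; _≢_; refl; sym; trans; ≢-sym; cong; cong₂; subst; module ≡-Reasoning)
open import Relation.Nullary using (contradiction)
open ≡-Reasoning

private variable
  A B : Set


length-++-∷ : ∀ (xs : List A) y ys → length (xs ++ y ∷ ys) ≡ suc (length (xs ++ ys))
length-++-∷ xs y ys = trans (length-++ xs) (trans (+-suc (length xs) (length ys)) (cong suc (sym (length-++ xs))))

<-length-insert : ∀ {n} (xs : List A) y ys → n < length (xs ++ ys) → suc n < length (xs ++ y ∷ ys)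
<-length-insert xs y ys n<len = subst (_ <_) (sym (length-++-∷ xs y ys)) (s<s n<len)

module _ {R : A → A → Set} where

  AllPairs-delete : ∀ xs {y ys} → AllPairs R (xs ++ y ∷ ys) → AllPairs R (xs ++ ys)
  AllPairs-delete []       (_ ∷ rs)  = rs
  AllPairs-delete (x ∷ xs) (px ∷ rs) =
    All.++⁺ (All.++⁻ˡ xs px) (All.tail (All.++⁻ʳ xs px)) ∷ AllPairs-delete xs rs

  AllPairs-between : ∀ xs {y} ys {z zs} → AllPairs R (xs ++ y ∷ ys ++ z ∷ zs) → R y z
  AllPairs-between []       ys (py ∷ _) = All.head (All.++⁻ʳ ys py)
  AllPairs-between (x ∷ xs) ys (_ ∷ rs) = AllPairs-between xs ys rs

Descending : List ℕ → Set
Descending = AllPairs _>_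

down : ℕ → List ℕ
down = applyDownFrom suc

down-descending : ∀ m → Descending (down m)
down-descending m = applyDownFrom⁺₁ suc m (λ j<i _ → s<s j<i)


when : Bool → ℕ → ℕ
when true  m = m
when false m = 0

when-zero : ∀ b → when b 0 ≡ 0
when-zero true  = refl
when-zero false = refl

when-≡0 : ∀ b {m} → m ≡ 0 → when b m ≡ 0
when-≡0 b refl = when-zero b

when-+ : ∀ b m n → when b (m + n) ≡ when b m + when b n
when-+ true  m n = refl
when-+ false m n = refl

when-* : ∀ b c m → when b (c * m) ≡ c * when b m
when-* true  c m = refl
when-* false c m = sym (*-zeroʳ c)

when-∧ : ∀ b c m → when (b ∧ c) m ≡ when b (when c m)
when-∧ true  c m = refl
when-∧ false c m = refl

when-linear₃ : ∀ b {p q r s} → p + q + r ≡ s → when b p + when b q + when b r ≡ when b s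
when-linear₃ true  eq = eq
when-linear₃ false eq = refl

when-linear₃₂ : ∀ b {p q r s u} → p + q + r ≡ s + u → when b p + when b q + when b r ≡ when b s + when b u
when-linear₃₂ true  eq = eq
when-linear₃₂ false eq = refl

interchange₃ : ∀ a b c x y z → (a + x) + (b + y) + (c + z) ≡ (a + b + c) + (x + y + z)
interchange₃ = solve-∀

when-combine₃ : ∀ t p₁ p₂ p₃ q₁ q₂ q₃ {p q} → p₁ + p₂ + p₃ ≡ p → q₁ + q₂ + q₃ ≡ q →
  (p₁ + when t q₁) + (p₂ + when t q₂) + (p₃ + when t q₃) ≡ p + when t q
when-combine₃ t p₁ p₂ p₃ q₁ q₂ q₃ eq₁ eq₂ =
  trans (interchange₃ p₁ p₂ p₃ (when t q₁) (when t q₂) (when t q₃)) (cong₂ _+_ eq₁ (when-linear₃ t eq₂))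

when-combine₃₂ : ∀ t p₁ p₂ p₃ q₁ q₂ q₃ p p′ q q′ → p₁ + p₂ + p₃ ≡ p + p′ → q₁ + q₂ + q₃ ≡ q + q′ →
  (p₁ + when t q₁) + (p₂ + when t q₂) + (p₃ + when t q₃) ≡ (p + when t q) + (p′ + when t q′)
when-combine₃₂ t p₁ p₂ p₃ q₁ q₂ q₃ p p′ q q′ eq₁ eq₂ = begin
  (p₁ + when t q₁) + (p₂ + when t q₂) + (p₃ + when t q₃)
    ≡⟨ when-combine₃ t p₁ p₂ p₃ q₁ q₂ q₃ refl refl ⟩
  (p₁ + p₂ + p₃) + when t (q₁ + q₂ + q₃)
    ≡⟨ cong₂ (λ x y → x + when t y) eq₁ eq₂ ⟩
  (p + p′) + when t (q + q′)
    ≡⟨ cong ((p + p′) +_) (when-+ t q q′) ⟩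
  (p + p′) + (when t q + when t q′)
    ≡⟨ interchange p p′ (when t q) (when t q′) ⟩
  (p + when t q) + (p′ + when t q′) ∎

sumSplits : (List A → A → List A → ℕ) → List A → ℕ
sumSplits f []       = 0
sumSplits f (x ∷ xs) = f [] x xs + sumSplits (λ a y b → f (x ∷ a) y b) xs

sumSplits-cong : {f g : List A → A → List A → ℕ} → ∀ L →
                 (∀ a x b → a ++ x ∷ b ≡ L → f a x b ≡ g a x b) → sumSplits f L ≡ sumSplits g L
sumSplits-cong []       eq = refl
sumSplits-cong (x ∷ xs) eq =
  cong₂ _+_ (eq [] x xs refl) (sumSplits-cong xs (λ a y b e → eq (x ∷ a) y b (cong (x ∷_) e)))

sumSplits-zero : {f : List A → A → List A → ℕ} → ∀ L →
                 (∀ a x b → a ++ x ∷ b ≡ L → f a x b ≡ 0) → sumSplits f L ≡ 0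
sumSplits-zero []       eq = refl
sumSplits-zero (x ∷ xs) eq =
  cong₂ _+_ (eq [] x xs refl) (sumSplits-zero xs (λ a y b e → eq (x ∷ a) y b (cong (x ∷_) e)))

sumSplits-+ : ∀ (f g : List A → A → List A → ℕ) L →
              sumSplits (λ a x b → f a x b + g a x b) L ≡ sumSplits f L + sumSplits g L
sumSplits-+ f g []       = refl
sumSplits-+ f g (x ∷ xs) = trans
  (cong (f [] x xs + g [] x xs +_) (sumSplits-+ (λ a y b → f (x ∷ a) y b) (λ a y b → g (x ∷ a) y b) xs))
  (interchange (f [] x xs) (g [] x xs) _ _)

sumSplits-+₃ : ∀ (f g h : List A → A → List A → ℕ) L →
               sumSplits (λ a x b → f a x b + g a x b + h a x b) L
               ≡ sumSplits f L + sumSplits g L + sumSplits h L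
sumSplits-+₃ f g h L =
  trans (sumSplits-+ (λ a x b → f a x b + g a x b) h L) (cong (_+ sumSplits h L) (sumSplits-+ f g L))

sumSplits-* : ∀ c (f : List A → A → List A → ℕ) L →
              sumSplits (λ a x b → c * f a x b) L ≡ c * sumSplits f L
sumSplits-* c f []       = sym (*-zeroʳ c)
sumSplits-* c f (x ∷ xs) = trans
  (cong (c * f [] x xs +_) (sumSplits-* c (λ a y b → f (x ∷ a) y b) xs))
  (sym (*-distribˡ-+ c (f [] x xs) _))

sumSplits-when : ∀ c (f : List A → A → List A → ℕ) L →
                 sumSplits (λ a x b → when c (f a x b)) L ≡ when c (sumSplits f L)
sumSplits-when true  f L = refl
sumSplits-when false f L = sumSplits-zero L (λ _ _ _ _ → refl)

sumSplits-++ : ∀ (f : List A → A → List A → ℕ) P Q →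
               sumSplits f (P ++ Q) ≡
               sumSplits (λ a x b → f a x (b ++ Q)) P + sumSplits (λ a x b → f (P ++ a) x b) Q
sumSplits-++ f []      Q = refl
sumSplits-++ f (p ∷ P) Q = trans
  (cong (f [] p (P ++ Q) +_) (sumSplits-++ (λ a y b → f (p ∷ a) y b) P Q))
  (sym (+-assoc (f [] p (P ++ Q)) _ _))

sumSplits-++-∷ : ∀ (f : List A → A → List A → ℕ) P x Q →
                 sumSplits f (P ++ x ∷ Q) ≡
                 sumSplits (λ a y b → f a y (b ++ x ∷ Q)) P
                 + (f P x Q + sumSplits (λ a y b → f (P ++ x ∷ a) y b) Q)
sumSplits-++-∷ f P x Q =
  trans (sumSplits-++ f P (x ∷ Q)) (cong (λ P′ → before + (f P′ x Q + after)) (++-identityʳ P))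
  where
  before after : ℕ
  before = sumSplits (λ a y b → f a y (b ++ x ∷ Q)) P
  after  = sumSplits (λ a y b → f (P ++ x ∷ a) y b) Q

sumSplits-map : ∀ (h : A → B) (f : List B → B → List B → ℕ) L →
                sumSplits f (map h L) ≡ sumSplits (λ a x b → f (map h a) (h x) (map h b)) L
sumSplits-map h f []       = refl
sumSplits-map h f (x ∷ xs) = cong (f [] (h x) (map h xs) +_) (sumSplits-map h (λ a y b → f (h x ∷ a) y b) xs)

sumSplits-const : ∀ (f : A → ℕ) L → sumSplits (λ _ x _ → f x) L ≡ sum (map f L)
sumSplits-const f []       = refl
sumSplits-const f (x ∷ xs) = cong (f x +_) (sumSplits-const f xs)

sumSplits-unique : ∀ {f : List A → A → List A → ℕ} p j q → Unique (p ++ j ∷ q) →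
                   (∀ a k b → k ≢ j → f a k b ≡ 0) → sumSplits f (p ++ j ∷ q) ≡ f p j q
sumSplits-unique {f = f} p j q uniq off = begin
  sumSplits f (p ++ j ∷ q)
    ≡⟨ sumSplits-++-∷ f p j q ⟩
  sumSplits (λ a k b → f a k (b ++ j ∷ q)) p + (f p j q + sumSplits (λ a k b → f (p ++ j ∷ a) k b) q)
    ≡⟨ cong₂ (λ x y → x + (f p j q + y)) (sumSplits-zero p inP) (sumSplits-zero q inQ) ⟩
  f p j q + 0
    ≡⟨ +-identityʳ _ ⟩
  f p j q ∎
  where
  inP : ∀ a k b → a ++ k ∷ b ≡ p → f a k (b ++ j ∷ q) ≡ 0
  inP a k b refl = off a k _ (AllPairs-between a b (subst Unique (++-assoc a (k ∷ b) (j ∷ q)) uniq))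
  inQ : ∀ a k b → a ++ k ∷ b ≡ q → f (p ++ j ∷ a) k b ≡ 0
  inQ a k b refl = off _ k b (≢-sym (AllPairs-between p a uniq))

sum-map-++ : ∀ (f : A → ℕ) xs ys → sum (map f (xs ++ ys)) ≡ sum (map f xs) + sum (map f ys)
sum-map-++ f xs ys = trans (cong sum (map-++ f xs ys)) (sum-++ (map f xs) (map f ys))

sum-map-concatMap : ∀ (f : B → ℕ) (g : A → List B) xs →
                    sum (map f (concatMap g xs)) ≡ sum (map (λ x → sum (map f (g x))) xs)
sum-map-concatMap f g []       = refl
sum-map-concatMap f g (x ∷ xs) =
  trans (sum-map-++ f (g x) _) (cong (sum (map f (g x)) +_) (sum-map-concatMap f g xs))

sum-map-+ : ∀ (f g : A → ℕ) xs → sum (map (λ x → f x + g x) xs) ≡ sum (map f xs) + sum (map g xs)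
sum-map-+ f g []       = refl
sum-map-+ f g (x ∷ xs) = trans (cong (f x + g x +_) (sum-map-+ f g xs)) (interchange (f x) (g x) _ _)

sum-map-zero : ∀ {f : A → ℕ} xs → (∀ x → f x ≡ 0) → sum (map f xs) ≡ 0
sum-map-zero []       eq = refl
sum-map-zero (x ∷ xs) eq = cong₂ _+_ (eq x) (sum-map-zero xs eq)

sum-map-when : ∀ c (f : A → ℕ) xs → sum (map (λ x → when c (f x)) xs) ≡ when c (sum (map f xs))
sum-map-when true  f xs = refl
sum-map-when false f xs = sum-map-zero xs (λ _ → refl)

sum-map-down : ∀ (f : ℕ → ℕ) m → sum (map f (down m)) ≡ sum1to m f
sum-map-down f m = begin
  sum (map f (down m))
    ≡⟨ cong (sum ∘ map f) (sym (reverse-applyUpTo suc m)) ⟩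
  sum (map f (reverse (applyUpTo suc m)))
    ≡⟨ cong sum (reverse-map f (applyUpTo suc m)) ⟩
  sum (reverse (map f (applyUpTo suc m)))
    ≡⟨ sum-↭ (↭-reverse (map f (applyUpTo suc m))) ⟩
  sum (map f (applyUpTo suc m))
    ≡⟨ cong sum (map-applyUpTo suc f m) ⟩
  sum (applyUpTo (λ i → f (suc i)) m)
    ≡⟨ cong sum (sym (map-upTo (λ i → f (suc i)) m)) ⟩
  sum1to m f ∎

length-filterᵇ : ∀ (p : A → Bool) xs → length (filterᵇ p xs) ≡ sum (map (λ x → when (p x) 1) xs)
length-filterᵇ p []       = refl
length-filterᵇ p (x ∷ xs) with p x
... | true  = cong suc (length-filterᵇ p xs)
... | false = length-filterᵇ p xs


T⇒≡true : ∀ {b} → T b → b ≡ true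
T⇒≡true = Equivalence.to T-≡

<ᵇ-true : ∀ {m n} → m < n → (m <ᵇ n) ≡ true
<ᵇ-true m<n = T⇒≡true (<⇒<ᵇ m<n)

≤⇒<ᵇ-false : ∀ {m n} → n ≤ m → (m <ᵇ n) ≡ false
≤⇒<ᵇ-false {m} {n} n≤m with m <ᵇ n in eq
... | false = refl
... | true  = contradiction (<ᵇ⇒< m n (subst T (sym eq) tt)) (≤⇒≯ n≤m)

≢⇒≡ᵇ-false : ∀ {m n} → m ≢ n → (m ≡ᵇ n) ≡ false
≢⇒≡ᵇ-false {m} {n} m≢n with m ≡ᵇ n in eq
... | false = refl
... | true  = contradiction (≡ᵇ⇒≡ m n (subst T (sym eq) tt)) m≢n

even?≡not-odd? : ∀ n → even? n ≡ not (odd? n)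
even?≡not-odd? zero          = refl
even?≡not-odd? (suc zero)    = refl
even?≡not-odd? (suc (suc n)) = even?≡not-odd? n

odd?-suc : ∀ k → odd? (suc k) ≡ not (odd? k)
odd?-suc zero          = refl
odd?-suc (suc zero)    = refl
odd?-suc (suc (suc k)) = odd?-suc k

stepOK : ℕ → ℕ → Bool
stepOK k j = not (k <ᵇ j) ∨ (odd? k ∧ even? j)

stepOK-descent : ∀ {k j} → j < k → stepOK k j ≡ true
stepOK-descent {k} {j} j<k = cong (λ b → not b ∨ (odd? k ∧ even? j)) (≤⇒<ᵇ-false (<⇒≤ j<k))

stepOK-ascent : ∀ {k j} → k < j → ∀ m → when (stepOK k j) m ≡ when (odd? k) (when (not (odd? j)) m)
stepOK-ascent {k} {j} k<j m
  rewrite T⇒≡true (<⇒<ᵇ k<j) | even?≡not-odd? j with odd? k | odd? j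
... | true  | true  = refl
... | true  | false = refl
... | false | _     = refl


-- Valid words by their first letter

permsOf : List ℕ → List (List ℕ)
permsOf []      = [] ∷ []
permsOf (a ∷ A) = concatMap (insertions a) (permsOf A)

perms≡permsOf-down : ∀ m → perms m ≡ permsOf (down m)
perms≡permsOf-down zero    = refl
perms≡permsOf-down (suc m) = cong (concatMap (insertions (suc m))) (perms≡permsOf-down m)

sum-insertions : ∀ (g : List ℕ → ℕ) a k ρ →
                 sum (map g (insertions a (k ∷ ρ)))
                 ≡ g (a ∷ k ∷ ρ) + sum (map (λ τ → g (k ∷ τ)) (insertions a ρ))
sum-insertions g a k ρ = cong (g (a ∷ k ∷ ρ) +_) (cong sum (sym (map-∘ (insertions a ρ))))

sum-permsOf-byHead : ∀ a A (g : List ℕ → ℕ) →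
  sum (map g (permsOf (a ∷ A)))
  ≡ sumSplits (λ p k q → sum (map (λ ρ → g (k ∷ ρ)) (permsOf (p ++ q)))) (a ∷ A)
sum-permsOf-byHead a []       g = sym (+-identityʳ _)
sum-permsOf-byHead a (b ∷ A) g = begin
  sum (map g (concatMap (insertions a) (permsOf (b ∷ A))))
    ≡⟨ sum-map-concatMap g (insertions a) (permsOf (b ∷ A)) ⟩
  sum (map (λ σ → sum (map g (insertions a σ))) (permsOf (b ∷ A)))
    ≡⟨ sum-permsOf-byHead b A (λ σ → sum (map g (insertions a σ))) ⟩
  sumSplits (λ p k q → sum (map (λ ρ → sum (map g (insertions a (k ∷ ρ)))) (permsOf (p ++ q)))) (b ∷ A)
    ≡⟨ sumSplits-cong (b ∷ A) (λ p k q _ → split p k q) ⟩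
  sumSplits (λ p k q → headA p k q + headK p k q) (b ∷ A)
    ≡⟨ sumSplits-+ headA headK (b ∷ A) ⟩
  sumSplits headA (b ∷ A) + sumSplits headK (b ∷ A)
    ≡⟨ cong (_+ sumSplits headK (b ∷ A)) (sym (sum-permsOf-byHead b A (λ σ → g (a ∷ σ)))) ⟩
  sum (map (λ σ → g (a ∷ σ)) (permsOf (b ∷ A))) + sumSplits headK (b ∷ A) ∎
  where
  headA headK : List ℕ → ℕ → List ℕ → ℕ
  headA p k q = sum (map (λ ρ → g (a ∷ k ∷ ρ)) (permsOf (p ++ q)))
  headK p k q = sum (map (λ τ → g (k ∷ τ)) (permsOf (a ∷ p ++ q)))
  split : ∀ p k q →
          sum (map (λ ρ → sum (map g (insertions a (k ∷ ρ)))) (permsOf (p ++ q))) ≡ headA p k q + headK p k q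
  split p k q = begin
    sum (map (λ ρ → sum (map g (insertions a (k ∷ ρ)))) (permsOf (p ++ q)))
      ≡⟨ cong sum (map-cong (sum-insertions g a k) (permsOf (p ++ q))) ⟩
    sum (map (λ ρ → g (a ∷ k ∷ ρ) + sum (map (λ τ → g (k ∷ τ)) (insertions a ρ))) (permsOf (p ++ q)))
      ≡⟨ sum-map-+ _ _ (permsOf (p ++ q)) ⟩
    headA p k q + sum (map (λ ρ → sum (map (λ τ → g (k ∷ τ)) (insertions a ρ))) (permsOf (p ++ q)))
      ≡⟨ cong (headA p k q +_) (sym (sum-map-concatMap _ (insertions a) (permsOf (p ++ q)))) ⟩
    headA p k q + headK p k q ∎

countFrom : ℕ → List ℕ → ℕ
countFrom k A = sum (map (λ ρ → when (ascentsOK (k ∷ ρ)) 1) (permsOf A))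

countFrom-byHead : ∀ k a A →
  countFrom k (a ∷ A) ≡ sumSplits (λ p j q → when (stepOK k j) (countFrom j (p ++ q))) (a ∷ A)
countFrom-byHead k a A = trans (sum-permsOf-byHead a A _) (sumSplits-cong (a ∷ A) λ p j q _ →
  trans (cong sum (map-cong (λ ρ → when-∧ (stepOK k j) (ascentsOK (j ∷ ρ)) 1) (permsOf (p ++ q))))
        (sum-map-when (stepOK k j) _ (permsOf (p ++ q))))

countFrom-nonempty : ∀ {n} k A → length A ≡ suc n →
  countFrom k A ≡ sumSplits (λ p j q → when (stepOK k j) (countFrom j (p ++ q))) A
countFrom-nonempty k (a ∷ A) _ = countFrom-byHead k a A

GIk≡countFrom : ∀ m p j q → p ++ j ∷ q ≡ down (suc m) → GIk (suc m) j ≡ countFrom j (p ++ q)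
GIk≡countFrom m p j q split = begin
  GIk (suc m) j
    ≡⟨ length-filterᵇ _ (perms (suc m)) ⟩
  sum (map indicator (perms (suc m)))
    ≡⟨ cong (sum ∘ map indicator) (perms≡permsOf-down (suc m)) ⟩
  sum (map indicator (permsOf (down (suc m))))
    ≡⟨ sum-permsOf-byHead (suc m) (down m) indicator ⟩
  sumSplits byHead (down (suc m))
    ≡⟨ cong (sumSplits byHead) (sym split) ⟩
  sumSplits byHead (p ++ j ∷ q)
    ≡⟨ sumSplits-unique p j q (subst Unique (sym split) (AllPairs.map >⇒≢ (down-descending (suc m)))) off ⟩
  byHead p j q
    ≡⟨ cong sum (map-cong on (permsOf (p ++ q))) ⟩
  countFrom j (p ++ q) ∎
  where
  indicator : List ℕ → ℕ
  indicator π = when (ascentsOK π ∧ firstIs j π) 1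
  byHead : List ℕ → ℕ → List ℕ → ℕ
  byHead a k b = sum (map (λ ρ → indicator (k ∷ ρ)) (permsOf (a ++ b)))
  off : ∀ a k b → k ≢ j → byHead a k b ≡ 0
  off a k b k≢j = sum-map-zero (permsOf (a ++ b)) λ ρ → trans
    (cong (λ c → when (ascentsOK (k ∷ ρ) ∧ c) 1) (≢⇒≡ᵇ-false k≢j)) (cong (λ c → when c 1) (∧-zeroʳ _))
  on : ∀ ρ → indicator (j ∷ ρ) ≡ when (ascentsOK (j ∷ ρ)) 1
  on ρ = trans (cong (λ c → when (ascentsOK (j ∷ ρ) ∧ c) 1) (T⇒≡true (≡⇒≡ᵇ j j refl)))
               (cong (λ c → when c 1) (∧-identityʳ _))

GI≡sumSplits-countFrom : ∀ m → GI (suc m) ≡ sumSplits (λ p j q → countFrom j (p ++ q)) (down (suc m))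
GI≡sumSplits-countFrom m = begin
  GI (suc m)
    ≡⟨ length-filterᵇ ascentsOK (perms (suc m)) ⟩
  sum (map (λ π → when (ascentsOK π) 1) (perms (suc m)))
    ≡⟨ cong (sum ∘ map (λ π → when (ascentsOK π) 1)) (perms≡permsOf-down (suc m)) ⟩
  sum (map (λ π → when (ascentsOK π) 1) (permsOf (down (suc m))))
    ≡⟨ sum-permsOf-byHead (suc m) (down m) (λ π → when (ascentsOK π) 1) ⟩
  sumSplits (λ p j q → countFrom j (p ++ q)) (down (suc m)) ∎

sum1to≡sumSplits-countFrom : ∀ m →
  sum1to (suc m) (GIk (suc m)) ≡ sumSplits (λ p j q → countFrom j (p ++ q)) (down (suc m))
sum1to≡sumSplits-countFrom m = begin
  sum1to (suc m) (GIk (suc m))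
    ≡⟨ sum-map-down (GIk (suc m)) (suc m) ⟨
  sum (map (GIk (suc m)) (down (suc m)))
    ≡⟨ sumSplits-const (GIk (suc m)) (down (suc m)) ⟨
  sumSplits (λ _ j _ → GIk (suc m) j) (down (suc m))
    ≡⟨ sumSplits-cong (down (suc m)) (GIk≡countFrom m) ⟩
  sumSplits (λ p j q → countFrom j (p ++ q)) (down (suc m)) ∎


-- Counting up to parity

-- ways n H t L counts the valid words that begin with a fixed letter k of parity t
-- (true = odd) and continue with the n remaining letters, of which those above k have
-- parity word H and those below k have parity word L, both read in decreasing order.
-- Only the parities matter: a descent is always allowed, and an ascent needs an odd
-- letter followed by an even one.  The fuel n must be the number of remaining letters;
-- for any other n the count is 0.
mutual
  ways : ℕ → List Bool → Bool → List Bool → ℕ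
  ways zero    []      t []      = 1
  ways zero    _       t _       = 0
  ways (suc n) H t L = descents n H L + when t (ascents n H L)

  descents : ℕ → List Bool → List Bool → ℕ
  descents n H L = sumSplits (λ a x b → ways n (H ++ a) x b) L

  ascents : ℕ → List Bool → List Bool → ℕ
  ascents n H L = sumSplits (λ a x b → when (not x) (ways n a x (b ++ L))) H

ParityTransfer : ℕ → Set
ParityTransfer n = ∀ Hs k Ls → length (Hs ++ Ls) ≡ n → Descending (Hs ++ k ∷ Ls) →
                   countFrom k (Hs ++ Ls) ≡ ways n (map odd? Hs) (odd? k) (map odd? Ls)

module ParityTransferStep {n} (ih : ParityTransfer n) {Hs k Ls}
         (len : length (Hs ++ Ls) ≡ suc n) (desc : Descending (Hs ++ k ∷ Ls)) where

  nextBelow : ∀ p j q → p ++ j ∷ q ≡ Ls →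
    when (stepOK k j) (countFrom j ((Hs ++ p) ++ q)) ≡ ways n (map odd? Hs ++ map odd? p) (odd? j) (map odd? q)
  nextBelow p j q refl = begin
    when (stepOK k j) (countFrom j ((Hs ++ p) ++ q))
      ≡⟨ cong (λ b → when b _) (stepOK-descent (AllPairs-between Hs p desc)) ⟩
    countFrom j ((Hs ++ p) ++ q)
      ≡⟨ ih (Hs ++ p) j q len′ desc′ ⟩
    ways n (map odd? (Hs ++ p)) (odd? j) (map odd? q)
      ≡⟨ cong (λ H → ways n H (odd? j) (map odd? q)) (map-++ odd? Hs p) ⟩
    ways n (map odd? Hs ++ map odd? p) (odd? j) (map odd? q) ∎
    where
    reassoc : Hs ++ p ++ j ∷ q ≡ (Hs ++ p) ++ j ∷ q
    reassoc = sym (++-assoc Hs p (j ∷ q))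
    len′ : length ((Hs ++ p) ++ q) ≡ n
    len′ = suc-injective (trans (sym (length-++-∷ (Hs ++ p) j q)) (trans (cong length (sym reassoc)) len))
    desc′ : Descending ((Hs ++ p) ++ j ∷ q)
    desc′ = subst Descending reassoc (AllPairs-delete Hs desc)

  nextAbove : ∀ p j q → p ++ j ∷ q ≡ Hs →
    when (stepOK k j) (countFrom j (p ++ q ++ Ls))
      ≡ when (odd? k) (when (not (odd? j)) (ways n (map odd? p) (odd? j) (map odd? q ++ map odd? Ls)))
  nextAbove p j q refl = begin
    when (stepOK k j) (countFrom j (p ++ q ++ Ls))
      ≡⟨ stepOK-ascent (AllPairs-between p q (subst Descending reassoc desc)) _ ⟩
    when (odd? k) (when (not (odd? j)) (countFrom j (p ++ q ++ Ls)))
      ≡⟨ cong (λ m → when (odd? k) (when (not (odd? j)) m)) (ih p j (q ++ Ls) len′ desc′) ⟩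
    when (odd? k) (when (not (odd? j)) (ways n (map odd? p) (odd? j) (map odd? (q ++ Ls))))
      ≡⟨ cong (λ L → when (odd? k) (when (not (odd? j)) (ways n (map odd? p) (odd? j) L))) (map-++ odd? q Ls) ⟩
    when (odd? k) (when (not (odd? j)) (ways n (map odd? p) (odd? j) (map odd? q ++ map odd? Ls))) ∎
    where
    reassoc : ∀ {xs} → (p ++ j ∷ q) ++ xs ≡ p ++ j ∷ q ++ xs
    reassoc = ++-assoc p (j ∷ q) _
    len′ : length (p ++ q ++ Ls) ≡ n
    len′ = suc-injective (trans (sym (length-++-∷ p j (q ++ Ls))) (trans (cong length (sym reassoc)) len))
    desc′ : Descending (p ++ j ∷ q ++ Ls)
    desc′ = subst Descending reassoc (AllPairs-delete (p ++ j ∷ q) desc)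

parityTransfer : ∀ n → ParityTransfer n
parityTransfer zero    [] k [] _ _ = refl
parityTransfer (suc n) Hs k Ls len desc = begin
  countFrom k (Hs ++ Ls)
    ≡⟨ countFrom-nonempty k (Hs ++ Ls) len ⟩
  sumSplits F (Hs ++ Ls)
    ≡⟨ sumSplits-++ F Hs Ls ⟩
  sumSplits (λ p j q → F p j (q ++ Ls)) Hs + sumSplits (λ p j q → F (Hs ++ p) j q) Ls
    ≡⟨ +-comm (sumSplits (λ p j q → F p j (q ++ Ls)) Hs) _ ⟩
  sumSplits (λ p j q → F (Hs ++ p) j q) Ls + sumSplits (λ p j q → F p j (q ++ Ls)) Hs
    ≡⟨ cong₂ _+_ (sumSplits-cong Ls nextBelow) (sumSplits-cong Hs nextAbove) ⟩
  sumSplits (λ p j q → ways n (map odd? Hs ++ map odd? p) (odd? j) (map odd? q)) Ls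
  + sumSplits (λ p j q → when (odd? k) (ascent p j q)) Hs
    ≡⟨ cong (_ +_) (sumSplits-when (odd? k) ascent Hs) ⟩
  sumSplits (λ p j q → ways n (map odd? Hs ++ map odd? p) (odd? j) (map odd? q)) Ls
  + when (odd? k) (sumSplits ascent Hs)
    ≡⟨ sym (cong₂ _+_ (sumSplits-map odd? (λ a x b → ways n (map odd? Hs ++ a) x b) Ls)
                      (cong (when (odd? k))
                            (sumSplits-map odd? (λ a x b → when (not x) (ways n a x (b ++ map odd? Ls))) Hs))) ⟩
  ways (suc n) (map odd? Hs) (odd? k) (map odd? Ls) ∎
  where
  open ParityTransferStep (parityTransfer n) len desc
  F : List ℕ → ℕ → List ℕ → ℕ
  F p j q = when (stepOK k j) (countFrom j (p ++ q))
  ascent : List ℕ → ℕ → List ℕ → ℕ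
  ascent p j q = when (not (odd? j)) (ways n (map odd? p) (odd? j) (map odd? q ++ map odd? Ls))

allWays : ℕ → List Bool → ℕ
allWays n L = sumSplits (λ a x b → ways n a x b) L

sumSplits-countFrom≡allWays : ∀ m →
  sumSplits (λ p j q → countFrom j (p ++ q)) (down (suc m)) ≡ allWays m (map odd? (down (suc m)))
sumSplits-countFrom≡allWays m = trans
  (sumSplits-cong (down (suc m)) (λ p j q split →
     parityTransfer m p j q (len split) (subst Descending (sym split) (down-descending (suc m)))))
  (sym (sumSplits-map odd? (λ a x b → ways m a x b) (down (suc m))))
  where
  len : ∀ {p j q} → p ++ j ∷ q ≡ down (suc m) → length (p ++ q) ≡ m
  len {p} {j} {q} split =
    suc-injective (trans (sym (length-++-∷ p j q)) (trans (cong length split) (length-applyDownFrom suc (suc m))))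


-- Identities for ways

descents-∷ : ∀ n K x L →
  descents n K (x ∷ L) ≡ ways n K x L + sumSplits (λ a y b → ways n (K ++ x ∷ a) y b) L
descents-∷ n K x L =
  cong (λ K′ → ways n K′ x L + sumSplits (λ a y b → ways n (K ++ x ∷ a) y b) L) (++-identityʳ K)

descents-snoc : ∀ n H x L → descents n (H ++ x ∷ []) L ≡ sumSplits (λ a y b → ways n (H ++ x ∷ a) y b) L
descents-snoc n H x L = sumSplits-cong L (λ a y b _ → cong (λ K → ways n K y b) (++-assoc H (x ∷ []) a))

descents-++ : ∀ n H l₁ l₂ →
  descents n H (l₁ ++ l₂)
  ≡ sumSplits (λ a x b → ways n (H ++ a) x (b ++ l₂)) l₁ + descents n (H ++ l₁) l₂
descents-++ n H l₁ l₂ = trans (sumSplits-++ (λ a x b → ways n (H ++ a) x b) l₁ l₂)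
  (cong (sumSplits (λ a x b → ways n (H ++ a) x (b ++ l₂)) l₁ +_)
        (sumSplits-cong l₂ (λ a x b _ → cong (λ K → ways n K x b) (sym (++-assoc H l₁ a)))))

ascents-++-∷ : ∀ n h x r L →
  ascents n (h ++ x ∷ r) L
  ≡ ascents n h (x ∷ r ++ L) + (when (not x) (ways n h x (r ++ L))
                                + sumSplits (λ a y b → when (not y) (ways n (h ++ x ∷ a) y (b ++ L))) r)
ascents-++-∷ n h x r L = trans (sumSplits-++-∷ (λ a y b → when (not y) (ways n a y (b ++ L))) h x r)
  (cong (_+ (when (not x) (ways n h x (r ++ L)) + sumSplits (λ a y b → when (not y) (ways n (h ++ x ∷ a) y (b ++ L))) r))
        (sumSplits-cong h (λ a y b _ → cong (λ R → when (not y) (ways n a y R)) (++-assoc b (x ∷ r) L))))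

ways-cong : ∀ n {H H′ t t′ L L′} → H ≡ H′ → t ≡ t′ → L ≡ L′ →
            ways n H t L ≡ ways n H′ t′ L′
ways-cong n refl refl refl = refl

ways-overfull : ∀ n H t L → n < length (H ++ L) → ways n H t L ≡ 0
ways-overfull zero    []      t (_ ∷ _) _     = refl
ways-overfull zero    (_ ∷ _) t _       _     = refl
ways-overfull (suc n) H       t L       n<len =
  cong₂ _+_ (sumSplits-zero L below) (when-≡0 t (sumSplits-zero H above))
  where
  below : ∀ a x b → a ++ x ∷ b ≡ L → ways n (H ++ a) x b ≡ 0
  below a x b refl = ways-overfull n (H ++ a) x b (s<s⁻¹ (subst (suc n <_) len n<len))
    where
    len : length (H ++ a ++ x ∷ b) ≡ suc (length ((H ++ a) ++ b))
    len = trans (cong length (sym (++-assoc H a (x ∷ b)))) (length-++-∷ (H ++ a) x b)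
  above : ∀ a x b → a ++ x ∷ b ≡ H → when (not x) (ways n a x (b ++ L)) ≡ 0
  above a x b refl = when-≡0 (not x) (ways-overfull n a x (b ++ L) (s<s⁻¹ (subst (suc n <_) len n<len)))
    where
    len : length ((a ++ x ∷ b) ++ L) ≡ suc (length (a ++ b ++ L))
    len = trans (cong length (++-assoc a (x ∷ b) L)) (length-++-∷ a x (b ++ L))

ways-oddTop : ∀ n H t L → ways n (true ∷ H) t L ≡ 0
ways-oddTop zero    H t L = refl
ways-oddTop (suc n) H t L = cong₂ _+_
  (sumSplits-zero L (λ a x b _ → ways-oddTop n (H ++ a) x b))
  (when-≡0 t (sumSplits-zero H (λ a x b _ → when-≡0 (not x) (ways-oddTop n a x (b ++ L)))))

ways-evenTopStart : ∀ n L → ways (suc n) [] false (true ∷ L) ≡ ways n [] false L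
ways-evenTopStart n L = begin
  (ways n [] true L + sumSplits (λ a x b → ways n (true ∷ a) x b) L) + 0
    ≡⟨ +-identityʳ _ ⟩
  ways n [] true L + sumSplits (λ a x b → ways n (true ∷ a) x b) L
    ≡⟨ cong₂ _+_ (noneAbove n L) (sumSplits-zero L (λ a x b _ → ways-oddTop n a x b)) ⟩
  ways n [] false L + 0
    ≡⟨ +-identityʳ _ ⟩
  ways n [] false L ∎
  where
  noneAbove : ∀ n L → ways n [] true L ≡ ways n [] false L
  noneAbove zero    []      = refl
  noneAbove zero    (_ ∷ _) = refl
  noneAbove (suc n) L       = refl

ways-evenTopStart-allWays : ∀ n L → ways (2 + n) [] false (true ∷ L) ≡ allWays n L
ways-evenTopStart-allWays n L = trans (ways-evenTopStart (suc n) L) (+-identityʳ _)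

evenBottom-overfull : ∀ H t L → 0 < length ((H ++ L) ++ []) → ways 1 H t (L ++ false ∷ []) ≡ ways 0 H t L
evenBottom-overfull H t L pos = trans
  (ways-overfull 1 H t (L ++ false ∷ [])
                 (subst (1 <_) (cong length (++-assoc H L _)) (<-length-insert (H ++ L) false [] pos)))
  (sym (ways-overfull 0 H t L (subst (0 <_) (cong length (++-identityʳ (H ++ L))) pos)))

ways-evenBottom : ∀ n H t L → ways (suc n) H t (L ++ false ∷ []) ≡ ways n H t L
descents-evenBottom : ∀ n H L → descents (suc n) H (L ++ false ∷ []) ≡ descents n H L
ascents-evenBottom : ∀ n H L → ascents (suc n) H (L ++ false ∷ []) ≡ ascents n H L

ways-evenBottom zero    []      t []      = cong suc (when-zero t)
ways-evenBottom zero    []      t (x ∷ L) = evenBottom-overfull [] t (x ∷ L) z<s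
ways-evenBottom zero    (x ∷ H) t L       = evenBottom-overfull (x ∷ H) t L z<s
ways-evenBottom (suc n) H t L = cong₂ _+_ (descents-evenBottom n H L) (cong (when t) (ascents-evenBottom n H L))

descents-evenBottom n H L = begin
  descents (suc n) H (L ++ false ∷ [])
    ≡⟨ sumSplits-++ (λ a x b → ways (suc n) (H ++ a) x b) L (false ∷ []) ⟩
  sumSplits (λ a x b → ways (suc n) (H ++ a) x (b ++ false ∷ [])) L + 0
    ≡⟨ +-identityʳ _ ⟩
  sumSplits (λ a x b → ways (suc n) (H ++ a) x (b ++ false ∷ [])) L
    ≡⟨ sumSplits-cong L (λ a x b _ → ways-evenBottom n (H ++ a) x b) ⟩
  descents n H L ∎

ascents-evenBottom n H L = sumSplits-cong H λ a x b _ → cong (when (not x))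
  (trans (cong (ways (suc n) a x) (sym (++-assoc b L (false ∷ [])))) (ways-evenBottom n a x (b ++ L)))

ways-evenOddTop : ∀ n H t L → ways (suc n) (false ∷ true ∷ H) t L ≡ ways n (false ∷ H) t L
ways-evenOddTop zero    H t L =
  cong₂ _+_ (sumSplits-zero L (λ _ _ _ _ → refl)) (when-≡0 t (sumSplits-zero H (λ _ x _ _ → when-zero (not x))))
ways-evenOddTop (suc n) H t L = cong₂ _+_
  (sumSplits-cong L (λ a x b _ → ways-evenOddTop n (H ++ a) x b))
  (cong (when t) (cong₂ _+_ (ways-evenTopStart n (H ++ L))
                            (sumSplits-cong H (λ a x b _ → cong (when (not x)) (ways-evenOddTop n a x (b ++ L))))))

ways-evenStart-oddBelow : ∀ n H L →
  ways (suc n) (H ++ true ∷ []) false L + ways n H true L ≡ ways (suc n) H false (true ∷ L)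
ways-evenStart-oddBelow n H L = begin
  (descents n (H ++ true ∷ []) L + 0) + ways n H true L
    ≡⟨ cong (_+ ways n H true L) (trans (+-identityʳ _) (descents-snoc n H true L)) ⟩
  σ + ways n H true L
    ≡⟨ +-comm σ _ ⟩
  ways n H true L + σ
    ≡⟨ descents-∷ n H true L ⟨
  descents n H (true ∷ L)
    ≡⟨ +-identityʳ _ ⟨
  descents n H (true ∷ L) + 0 ∎
  where
  σ : ℕ
  σ = sumSplits (λ a x b → ways n (H ++ true ∷ a) x b) L

ways-oddStart-evenBelow : ∀ n H L → ways (suc n) H true (false ∷ L) ≡ ways (suc n) (H ++ false ∷ []) true L
ways-oddStart-evenBelow n H L = begin
  descents n H (false ∷ L) + U
    ≡⟨ cong (_+ U) (descents-∷ n H false L) ⟩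
  (w + σ) + U
    ≡⟨ rearrange w σ U ⟩
  σ + (U + (w + 0))
    ≡⟨ cong₂ _+_ (descents-snoc n H false L) (ascents-++-∷ n H false [] L) ⟨
  descents n (H ++ false ∷ []) L + ascents n (H ++ false ∷ []) L ∎
  where
  U w σ : ℕ
  U = ascents n H (false ∷ L)
  w = ways n H false L
  σ = sumSplits (λ a x b → ways n (H ++ false ∷ a) x b) L
  rearrange : ∀ w d u → (w + d) + u ≡ d + (u + (w + 0))
  rearrange = solve-∀

ways-oddBottom-evenAbove : ∀ n H → ways (suc n) (H ++ false ∷ []) true [] ≡ ways n H true []
ways-oddBottom-evenAbove zero    []      = refl
ways-oddBottom-evenAbove zero    (x ∷ H) = ways-overfull 1 (x ∷ H ++ false ∷ []) true []
  (subst (1 <_) (cong length (sym (++-identityʳ (x ∷ H ++ false ∷ [])))) (<-length-insert (x ∷ H) false [] z<s))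
ways-oddBottom-evenAbove (suc n) H = begin
  ascents (suc n) (H ++ false ∷ []) []
    ≡⟨ ascents-++-∷ (suc n) H false [] [] ⟩
  ascents (suc n) H (false ∷ []) + 0
    ≡⟨ +-identityʳ _ ⟩
  ascents (suc n) H (false ∷ [])
    ≡⟨ ascents-evenBottom n H [] ⟩
  ascents n H [] ∎

ways-swapBottomPair : ∀ n H → ways (suc n) (H ++ false ∷ []) true [] ≡ ways (suc n) H false (true ∷ [])
ways-swapBottomPair n H = trans (ways-oddBottom-evenAbove n H) (ways-evenStart-oddBelow n H [])

evenOddBottom-overfull : ∀ H t L → 0 < length ((H ++ L) ++ []) →
                         ways 2 H t (L ++ false ∷ true ∷ []) ≡ 2 * ways 1 H t (L ++ true ∷ [])
evenOddBottom-overfull H t L pos =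
  trans (ways-overfull 2 H t _ (reassoc (<-length-insert (H ++ L) false _ one)))
        (cong (2 *_) (sym (ways-overfull 1 H t _ (reassoc one))))
  where
  reassoc : ∀ {n R} → n < length ((H ++ L) ++ R) → n < length (H ++ L ++ R)
  reassoc = subst (_ <_) (cong length (++-assoc H L _))
  one : 1 < length ((H ++ L) ++ true ∷ [])
  one = <-length-insert (H ++ L) true [] pos

ways-evenOddBottom : ∀ n H t L →
  ways (2 + n) H t (L ++ false ∷ true ∷ []) ≡ 2 * ways (suc n) H t (L ++ true ∷ [])
descents-evenOddBottom : ∀ n H L →
  descents (2 + n) H (L ++ false ∷ true ∷ []) ≡ 2 * descents (suc n) H (L ++ true ∷ [])
ascents-evenOddBottom : ∀ n H L →
  ascents (2 + n) H (L ++ false ∷ true ∷ []) ≡ 2 * ascents (suc n) H (L ++ true ∷ [])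

ways-evenOddBottom zero    []      true  []      = refl
ways-evenOddBottom zero    []      false []      = refl
ways-evenOddBottom zero    []      t     (x ∷ L) = evenOddBottom-overfull [] t (x ∷ L) z<s
ways-evenOddBottom zero    (x ∷ H) t     L       = evenOddBottom-overfull (x ∷ H) t L z<s
ways-evenOddBottom (suc n) H       t     L       = begin
  descents (2 + n) H (L ++ false ∷ true ∷ []) + when t (ascents (2 + n) H (L ++ false ∷ true ∷ []))
    ≡⟨ cong₂ (λ d u → d + when t u) (descents-evenOddBottom n H L) (ascents-evenOddBottom n H L) ⟩
  2 * D + when t (2 * U)
    ≡⟨ cong (2 * D +_) (when-* t 2 U) ⟩
  2 * D + 2 * when t U
    ≡⟨ *-distribˡ-+ 2 D (when t U) ⟨
  2 * ways (2 + n) H t (L ++ true ∷ []) ∎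
  where
  D U : ℕ
  D = descents (suc n) H (L ++ true ∷ [])
  U = ascents (suc n) H (L ++ true ∷ [])

descents-evenOddBottom n H L = begin
  descents (2 + n) H (L ++ false ∷ true ∷ [])
    ≡⟨ sumSplits-++ (λ a x b → ways (2 + n) (H ++ a) x b) L (false ∷ true ∷ []) ⟩
  sumSplits (λ a x b → ways (2 + n) (H ++ a) x (b ++ false ∷ true ∷ [])) L
  + (ways (2 + n) K false (true ∷ []) + (ways (2 + n) (H ++ L ++ false ∷ []) true [] + 0))
    ≡⟨ cong₂ _+_ (trans (sumSplits-cong L (λ a x b _ → ways-evenOddBottom n (H ++ a) x b))
                        (sumSplits-* 2 (λ a x b → ways (suc n) (H ++ a) x (b ++ true ∷ [])) L))
                 bottomPair ⟩
  2 * P + (Q + (Q + 0))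
    ≡⟨ pairs P Q ⟩
  2 * (P + (Q + 0))
    ≡⟨ cong (2 *_) (sumSplits-++ (λ a x b → ways (suc n) (H ++ a) x b) L (true ∷ [])) ⟨
  2 * descents (suc n) H (L ++ true ∷ []) ∎
  where
  K : List Bool
  K = H ++ L ++ []
  P Q : ℕ
  P = sumSplits (λ a x b → ways (suc n) (H ++ a) x (b ++ true ∷ [])) L
  Q = ways (suc n) K true []
  bottomPair : ways (2 + n) K false (true ∷ []) + (ways (2 + n) (H ++ L ++ false ∷ []) true [] + 0) ≡ Q + (Q + 0)
  bottomPair = cong₂ (λ u v → u + (v + 0)) (sym (ways-evenStart-oddBelow (suc n) K [])) (begin
    ways (2 + n) (H ++ L ++ false ∷ []) true []   ≡⟨ cong (λ K′ → ways (2 + n) K′ true []) (++-assoc H L (false ∷ [])) ⟨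
    ways (2 + n) ((H ++ L) ++ false ∷ []) true [] ≡⟨ ways-oddBottom-evenAbove (suc n) (H ++ L) ⟩
    ways (suc n) (H ++ L) true []                 ≡⟨ cong (λ L′ → ways (suc n) (H ++ L′) true []) (++-identityʳ L) ⟨
    Q                                             ∎)
  pairs : ∀ p q → 2 * p + (q + (q + 0)) ≡ 2 * (p + (q + 0))
  pairs = solve-∀

ascents-evenOddBottom n H L = trans (sumSplits-cong H (λ a x b _ → doubled a x b))
                                    (sumSplits-* 2 (λ a x b → when (not x) (ways (suc n) a x (b ++ L ++ true ∷ []))) H)
  where
  doubled : ∀ a x b → when (not x) (ways (2 + n) a x (b ++ L ++ false ∷ true ∷ []))
                      ≡ 2 * when (not x) (ways (suc n) a x (b ++ L ++ true ∷ []))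
  doubled a x b = begin
    when (not x) (ways (2 + n) a x (b ++ L ++ false ∷ true ∷ []))
      ≡⟨ cong (λ R → when (not x) (ways (2 + n) a x R)) (++-assoc b L _) ⟨
    when (not x) (ways (2 + n) a x ((b ++ L) ++ false ∷ true ∷ []))
      ≡⟨ cong (when (not x)) (ways-evenOddBottom n a x (b ++ L)) ⟩
    when (not x) (2 * ways (suc n) a x ((b ++ L) ++ true ∷ []))
      ≡⟨ when-* (not x) 2 _ ⟩
    2 * when (not x) (ways (suc n) a x ((b ++ L) ++ true ∷ []))
      ≡⟨ cong (λ R → 2 * when (not x) (ways (suc n) a x R)) (++-assoc b L _) ⟩
    2 * when (not x) (ways (suc n) a x (b ++ L ++ true ∷ [])) ∎

allWays-evenOddTop : ∀ n L → allWays (suc n) (false ∷ true ∷ L) ≡ 2 * ways (suc n) (false ∷ []) true L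
allWays-evenOddTop n L = begin
  ways (suc n) [] false (true ∷ L) + (ways (suc n) (false ∷ []) true L
                                      + sumSplits (λ a x b → ways (suc n) (false ∷ true ∷ a) x b) L)
    ≡⟨ cong₂ (λ u v → u + (ways (suc n) (false ∷ []) true L + v))
             (ways-evenTopStart n L) (sumSplits-cong L (λ a x b _ → ways-evenOddTop n a x b)) ⟩
  ways n [] false L + ((σ + (ways n [] false L + 0)) + σ)
    ≡⟨ twice (ways n [] false L) σ ⟩
  2 * ways (suc n) (false ∷ []) true L ∎
  where
  σ : ℕ
  σ = sumSplits (λ a x b → ways n (false ∷ a) x b) L
  twice : ∀ w s → w + ((s + (w + 0)) + s) ≡ 2 * (s + (w + 0))
  twice = solve-∀

ways-oddStart-evenOddBottom : ∀ n H →
  ways (3 + n) H true (false ∷ true ∷ [])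
  ≡ 2 * (ways (3 + n) (H ++ true ∷ false ∷ []) true [] + ways (suc n) H true [])
ways-oddStart-evenOddBottom n H = begin
  descents (2 + n) H (false ∷ true ∷ []) + ascents (2 + n) H (false ∷ true ∷ [])
    ≡⟨ cong₂ _+_ (descents-∷ (2 + n) H false (true ∷ [])) (ascents-evenOddBottom n H []) ⟩
  (ways (2 + n) H false (true ∷ []) + (ways (2 + n) (H ++ false ∷ []) true [] + 0)) + 2 * σ
    ≡⟨ cong (λ u → (u + (ways (2 + n) (H ++ false ∷ []) true [] + 0)) + 2 * σ) (ways-evenStart-oddBelow (suc n) H []) ⟨
  (w + (ways (2 + n) (H ++ false ∷ []) true [] + 0)) + 2 * σ
    ≡⟨ cong (λ v → (w + (v + 0)) + 2 * σ) (ways-oddBottom-evenAbove (suc n) H) ⟩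
  (w + (w + 0)) + 2 * σ
    ≡⟨ regroup w σ ⟩
  2 * ((σ + (0 + (0 + 0))) + w)
    ≡⟨ cong (λ u → 2 * ((u + (0 + (0 + 0))) + w)) (ascents-evenBottom (suc n) H (true ∷ [])) ⟨
  2 * ((ascents (2 + n) H (true ∷ false ∷ []) + (0 + (0 + 0))) + w)
    ≡⟨ cong (λ u → 2 * (u + w)) (ascents-++-∷ (2 + n) H true (false ∷ []) []) ⟨
  2 * (ways (3 + n) (H ++ true ∷ false ∷ []) true [] + w) ∎
  where
  w σ : ℕ
  w = ways (suc n) H true []
  σ = ascents (suc n) H (true ∷ [])
  regroup : ∀ w s → (w + (w + 0)) + 2 * s ≡ 2 * ((s + (0 + (0 + 0))) + w)
  regroup = solve-∀

SwapAboveAt : ℕ → List Bool → List Bool → Bool → List Bool → Set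
SwapAboveAt n h₁ h₂ t L =
  ways (2 + n) (h₁ ++ true ∷ false ∷ h₂) t L + ways (suc n) (h₁ ++ true ∷ h₂) t L
  + ways (suc n) (h₁ ++ false ∷ h₂) t L
  ≡ ways (2 + n) (h₁ ++ false ∷ true ∷ h₂) t L

SwapBelowAt : ℕ → List Bool → Bool → List Bool → List Bool → Set
SwapBelowAt n H t l₁ l₂ =
  ways (2 + n) H t (l₁ ++ true ∷ false ∷ l₂) + ways (suc n) H t (l₁ ++ true ∷ l₂)
  + ways (suc n) H t (l₁ ++ false ∷ l₂)
  ≡ ways (2 + n) H t (l₁ ++ false ∷ true ∷ l₂) + ways n H t (l₁ ++ l₂)

SwapAbove SwapBelow : ℕ → Set
SwapAbove n = ∀ h₁ h₂ t L → SwapAboveAt n h₁ h₂ t L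
SwapBelow n = ∀ H t l₁ l₂ → SwapBelowAt n H t l₁ l₂

swapAbove-overfull : ∀ h₁ h₂ t L → 0 < length (h₁ ++ h₂ ++ L) → SwapAboveAt 0 h₁ h₂ t L
swapAbove-overfull h₁ h₂ t L pos =
  trans (cong₂ _+_ (cong₂ _+_ (ways-overfull 2 (h₁ ++ true ∷ false ∷ h₂) t L (two true false))
                              (ways-overfull 1 (h₁ ++ true ∷ h₂) t L (one true)))
                   (ways-overfull 1 (h₁ ++ false ∷ h₂) t L (one false)))
        (sym (ways-overfull 2 (h₁ ++ false ∷ true ∷ h₂) t L (two false true)))
  where
  reassoc : ∀ {n} xs → n < length (h₁ ++ xs ++ L) → n < length ((h₁ ++ xs) ++ L)
  reassoc xs = subst (_ <_) (cong length (sym (++-assoc h₁ xs L)))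
  one : ∀ x → 1 < length ((h₁ ++ x ∷ h₂) ++ L)
  one x = reassoc (x ∷ h₂) (<-length-insert h₁ x (h₂ ++ L) pos)
  two : ∀ x y → 2 < length ((h₁ ++ x ∷ y ∷ h₂) ++ L)
  two x y = reassoc (x ∷ y ∷ h₂) (<-length-insert h₁ x (y ∷ h₂ ++ L) (<-length-insert h₁ y (h₂ ++ L) pos))

swapAbove-zero : SwapAbove 0
swapAbove-zero []       []       true  []      = refl
swapAbove-zero []       []       false []      = refl
swapAbove-zero []       []       t     (x ∷ L) = swapAbove-overfull [] [] t (x ∷ L) z<s
swapAbove-zero []       (x ∷ h₂) t     L       = swapAbove-overfull [] (x ∷ h₂) t L z<s
swapAbove-zero (x ∷ h₁) h₂       t     L       = swapAbove-overfull (x ∷ h₁) h₂ t L z<s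

swapBelow-overfull : ∀ H t l₁ l₂ → 0 < length ((H ++ l₁) ++ l₂) → SwapBelowAt 0 H t l₁ l₂
swapBelow-overfull H t l₁ l₂ pos =
  trans (cong₂ _+_ (cong₂ _+_ (ways-overfull 2 H t (l₁ ++ true ∷ false ∷ l₂) (two true false))
                              (ways-overfull 1 H t (l₁ ++ true ∷ l₂) (one true)))
                   (ways-overfull 1 H t (l₁ ++ false ∷ l₂) (one false)))
        (sym (cong₂ _+_ (ways-overfull 2 H t (l₁ ++ false ∷ true ∷ l₂) (two false true))
                        (ways-overfull 0 H t (l₁ ++ l₂) (reassoc l₂ pos))))
  where
  reassoc : ∀ {n} xs → n < length ((H ++ l₁) ++ xs) → n < length (H ++ l₁ ++ xs)
  reassoc xs = subst (_ <_) (cong length (++-assoc H l₁ xs))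
  one : ∀ x → 1 < length (H ++ l₁ ++ x ∷ l₂)
  one x = reassoc (x ∷ l₂) (<-length-insert (H ++ l₁) x l₂ pos)
  two : ∀ x y → 2 < length (H ++ l₁ ++ x ∷ y ∷ l₂)
  two x y = reassoc (x ∷ y ∷ l₂) (<-length-insert (H ++ l₁) x (y ∷ l₂) (<-length-insert (H ++ l₁) y l₂ pos))

swapBelow-zero : SwapBelow 0
swapBelow-zero []      true  []       []       = refl
swapBelow-zero []      false []       []       = refl
swapBelow-zero []      t     []       (x ∷ l₂) = swapBelow-overfull [] t [] (x ∷ l₂) z<s
swapBelow-zero []      t     (x ∷ l₁) l₂       = swapBelow-overfull [] t (x ∷ l₁) l₂ z<s
swapBelow-zero (x ∷ H) t     l₁       l₂       = swapBelow-overfull (x ∷ H) t l₁ l₂ z<s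

module SwapStep {m} (ih↑ : SwapAbove m) (ih↓ : SwapBelow m) where

  descentsAbove : ∀ h₁ h₂ L →
    descents (2 + m) (h₁ ++ true ∷ false ∷ h₂) L + descents (suc m) (h₁ ++ true ∷ h₂) L
    + descents (suc m) (h₁ ++ false ∷ h₂) L
    ≡ descents (2 + m) (h₁ ++ false ∷ true ∷ h₂) L
  descentsAbove h₁ h₂ L = trans (sym (sumSplits-+₃ _ _ _ L)) (sumSplits-cong L (λ a x b _ → pointwise a x b))
    where
    pointwise : ∀ a x b →
      ways (2 + m) ((h₁ ++ true ∷ false ∷ h₂) ++ a) x b + ways (suc m) ((h₁ ++ true ∷ h₂) ++ a) x b
      + ways (suc m) ((h₁ ++ false ∷ h₂) ++ a) x b ≡ ways (2 + m) ((h₁ ++ false ∷ true ∷ h₂) ++ a) x b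
    pointwise a x b
      rewrite ++-assoc h₁ (true ∷ false ∷ h₂) a | ++-assoc h₁ (true ∷ h₂) a
            | ++-assoc h₁ (false ∷ h₂) a | ++-assoc h₁ (false ∷ true ∷ h₂) a = ih↑ h₁ (h₂ ++ a) x b

  ascentsBelow : ∀ H l₁ l₂ →
    ascents (2 + m) H (l₁ ++ true ∷ false ∷ l₂) + ascents (suc m) H (l₁ ++ true ∷ l₂)
    + ascents (suc m) H (l₁ ++ false ∷ l₂)
    ≡ ascents (2 + m) H (l₁ ++ false ∷ true ∷ l₂) + ascents m H (l₁ ++ l₂)
  ascentsBelow H l₁ l₂ =
    trans (sym (sumSplits-+₃ _ _ _ H)) (trans (sumSplits-cong H (λ a x b _ → pointwise a x b)) (sumSplits-+ _ _ H))
    where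
    pointwise : ∀ a x b →
      when (not x) (ways (2 + m) a x (b ++ l₁ ++ true ∷ false ∷ l₂))
      + when (not x) (ways (suc m) a x (b ++ l₁ ++ true ∷ l₂))
      + when (not x) (ways (suc m) a x (b ++ l₁ ++ false ∷ l₂))
      ≡ when (not x) (ways (2 + m) a x (b ++ l₁ ++ false ∷ true ∷ l₂)) + when (not x) (ways m a x (b ++ l₁ ++ l₂))
    pointwise a x b
      rewrite sym (++-assoc b l₁ (true ∷ false ∷ l₂)) | sym (++-assoc b l₁ (true ∷ l₂))
            | sym (++-assoc b l₁ (false ∷ l₂)) | sym (++-assoc b l₁ (false ∷ true ∷ l₂)) | sym (++-assoc b l₁ l₂)
            = when-linear₃₂ (not x) (ih↓ a x (b ++ l₁) l₂)

  pairBelowTop : ∀ K l →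
    descents (2 + m) K (true ∷ false ∷ l) + descents (suc m) K (true ∷ l) + descents (suc m) K (false ∷ l)
    ≡ descents (2 + m) K (false ∷ true ∷ l) + descents m K l
  pairBelowTop K l = begin
    descents (2 + m) K (true ∷ false ∷ l) + descents (suc m) K (true ∷ l) + descents (suc m) K (false ∷ l)
      ≡⟨ cong₂ _+_ (cong₂ _+_ (descents-∷ (2 + m) K true (false ∷ l)) (descents-∷ (suc m) K true l))
                   (descents-∷ (suc m) K false l) ⟩
    (ways (2 + m) K true (false ∷ l) + (ways (2 + m) (K ++ true ∷ []) false l + σTF))
    + (ways (suc m) K true l + σT) + (ways (suc m) K false l + σF)
      ≡⟨ regroup (ways (2 + m) K true (false ∷ l)) (ways (2 + m) (K ++ true ∷ []) false l) σTF
                 (ways (suc m) K true l) σT (ways (suc m) K false l) σF ⟩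
    ((ways (2 + m) (K ++ true ∷ []) false l + ways (suc m) K true l)
     + (ways (2 + m) K true (false ∷ l) + (σTF + σT + σF)))
    + ways (suc m) K false l
      ≡⟨ cong₂ _+_ (cong₂ _+_ (ways-evenStart-oddBelow (suc m) K l)
                              (cong₂ _+_ (ways-oddStart-evenBelow (suc m) K l) suffix))
                   (+-identityʳ _) ⟩
    (ways (2 + m) K false (true ∷ l) + (ways (2 + m) (K ++ false ∷ []) true l + σFT)) + descents m K l
      ≡⟨ cong (_+ descents m K l) (descents-∷ (2 + m) K false (true ∷ l)) ⟨
    descents (2 + m) K (false ∷ true ∷ l) + descents m K l ∎
    where
    σTF σFT σT σF : ℕ
    σTF = sumSplits (λ a y b → ways (2 + m) (K ++ true ∷ false ∷ a) y b) l
    σFT = sumSplits (λ a y b → ways (2 + m) (K ++ false ∷ true ∷ a) y b) l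
    σT = sumSplits (λ a y b → ways (suc m) (K ++ true ∷ a) y b) l
    σF = sumSplits (λ a y b → ways (suc m) (K ++ false ∷ a) y b) l
    suffix : σTF + σT + σF ≡ σFT
    suffix = trans (sym (sumSplits-+₃ _ _ _ l)) (sumSplits-cong l (λ a y b _ → ih↑ K a y b))
    regroup : ∀ u₁ u₂ a v c w d → (u₁ + (u₂ + a)) + (v + c) + (w + d) ≡ ((u₂ + v) + (u₁ + (a + c + d))) + w
    regroup = solve-∀

  descentsBelow : ∀ H l₁ l₂ →
    descents (2 + m) H (l₁ ++ true ∷ false ∷ l₂) + descents (suc m) H (l₁ ++ true ∷ l₂)
    + descents (suc m) H (l₁ ++ false ∷ l₂)
    ≡ descents (2 + m) H (l₁ ++ false ∷ true ∷ l₂) + descents m H (l₁ ++ l₂)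
  descentsBelow H l₁ l₂ = begin
    descents (2 + m) H (l₁ ++ true ∷ false ∷ l₂) + descents (suc m) H (l₁ ++ true ∷ l₂)
    + descents (suc m) H (l₁ ++ false ∷ l₂)
      ≡⟨ cong₂ _+_ (cong₂ _+_ (descents-++ (2 + m) H l₁ _) (descents-++ (suc m) H l₁ _)) (descents-++ (suc m) H l₁ _) ⟩
    (pTF + dTF) + (pT + dT) + (pF + dF)
      ≡⟨ interchange₃ pTF pT pF dTF dT dF ⟩
    (pTF + pT + pF) + (dTF + dT + dF)
      ≡⟨ cong₂ _+_ prefixes (pairBelowTop K l₂) ⟩
    (pFT + p₀) + (dFT + d₀)
      ≡⟨ interchange pFT p₀ dFT d₀ ⟩
    (pFT + dFT) + (p₀ + d₀)
      ≡⟨ cong₂ _+_ (descents-++ (2 + m) H l₁ _) (descents-++ m H l₁ l₂) ⟨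
    descents (2 + m) H (l₁ ++ false ∷ true ∷ l₂) + descents m H (l₁ ++ l₂) ∎
    where
    K : List Bool
    K = H ++ l₁
    prefix : ℕ → List Bool → ℕ
    prefix n r = sumSplits (λ a x b → ways n (H ++ a) x (b ++ r)) l₁
    pTF pT pF pFT p₀ dTF dT dF dFT d₀ : ℕ
    pTF = prefix (2 + m) (true ∷ false ∷ l₂)
    pT  = prefix (suc m) (true ∷ l₂)
    pF  = prefix (suc m) (false ∷ l₂)
    pFT = prefix (2 + m) (false ∷ true ∷ l₂)
    p₀  = prefix m l₂
    dTF = descents (2 + m) K (true ∷ false ∷ l₂)
    dT  = descents (suc m) K (true ∷ l₂)
    dF  = descents (suc m) K (false ∷ l₂)
    dFT = descents (2 + m) K (false ∷ true ∷ l₂)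
    d₀  = descents m K l₂
    prefixes : pTF + pT + pF ≡ pFT + p₀
    prefixes = trans (sym (sumSplits-+₃ _ _ _ l₁))
                     (trans (sumSplits-cong l₁ (λ a x b _ → ih↓ (H ++ a) x b l₂)) (sumSplits-+ _ _ l₁))

  ascentsAbove : ∀ h₁ h₂ L →
    ascents (2 + m) (h₁ ++ true ∷ false ∷ h₂) L + ascents (suc m) (h₁ ++ true ∷ h₂) L
    + ascents (suc m) (h₁ ++ false ∷ h₂) L
    ≡ ascents (2 + m) (h₁ ++ false ∷ true ∷ h₂) L
  ascentsAbove h₁ h₂ L = begin
    ascents (2 + m) (h₁ ++ true ∷ false ∷ h₂) L + ascents (suc m) (h₁ ++ true ∷ h₂) L
    + ascents (suc m) (h₁ ++ false ∷ h₂) L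
      ≡⟨ cong₂ _+_ (cong₂ _+_ (ascents-++-∷ (2 + m) h₁ true (false ∷ h₂) L) (ascents-++-∷ (suc m) h₁ true h₂ L))
                   (ascents-++-∷ (suc m) h₁ false h₂ L) ⟩
    (pTF + (0 + (aₘ + sTF))) + (pT + (0 + sT)) + (pF + (dₘ + sF))
      ≡⟨ regroup pTF aₘ sTF pT sT pF dₘ sF ⟩
    (pTF + pT + pF) + (sTF + sT + sF) + (aₘ + dₘ)
      ≡⟨ cong₂ (λ p q → p + q + (aₘ + dₘ)) (ascentsBelow h₁ [] (h₂ ++ L)) suffixes ⟩
    (pFT + z) + sFT + (aₘ + dₘ)
      ≡⟨ regroup′ pFT z sFT aₘ dₘ ⟩
    pFT + ((aₘ + (dₘ + z)) + sFT)
      ≡⟨ cong (λ w → pFT + (w + sFT)) middle ⟩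
    pFT + (bₘ + sFT)
      ≡⟨ ascents-++-∷ (2 + m) h₁ false (true ∷ h₂) L ⟨
    ascents (2 + m) (h₁ ++ false ∷ true ∷ h₂) L ∎
    where
    suffix : ℕ → List Bool → ℕ
    suffix n p = sumSplits (λ a x b → when (not x) (ways n (h₁ ++ p ++ a) x (b ++ L))) h₂
    pTF pT pF pFT sTF sT sF sFT aₘ dₘ bₘ z : ℕ
    pTF = ascents (2 + m) h₁ (true ∷ false ∷ h₂ ++ L)
    pT  = ascents (suc m) h₁ (true ∷ h₂ ++ L)
    pF  = ascents (suc m) h₁ (false ∷ h₂ ++ L)
    pFT = ascents (2 + m) h₁ (false ∷ true ∷ h₂ ++ L)
    sTF = suffix (2 + m) (true ∷ false ∷ [])
    sT  = suffix (suc m) (true ∷ [])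
    sF  = suffix (suc m) (false ∷ [])
    sFT = suffix (2 + m) (false ∷ true ∷ [])
    aₘ  = ways (2 + m) (h₁ ++ true ∷ []) false (h₂ ++ L)
    dₘ  = ways (suc m) h₁ false (h₂ ++ L)
    bₘ  = ways (2 + m) h₁ false (true ∷ h₂ ++ L)
    z   = ascents m h₁ (h₂ ++ L)
    suffixes : sTF + sT + sF ≡ sFT
    suffixes = trans (sym (sumSplits-+₃ _ _ _ h₂))
                     (sumSplits-cong h₂ (λ a x b _ → when-linear₃ (not x) (ih↑ h₁ a x (b ++ L))))
    middle : aₘ + (dₘ + z) ≡ bₘ
    middle = trans (cong (λ d → aₘ + (d + z)) (+-identityʳ _)) (ways-evenStart-oddBelow (suc m) h₁ (h₂ ++ L))
    regroup : ∀ a₁ aₘ a₂ c₁ c₂ d₁ dₘ d₂ →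
      (a₁ + (0 + (aₘ + a₂))) + (c₁ + (0 + c₂)) + (d₁ + (dₘ + d₂)) ≡ (a₁ + c₁ + d₁) + (a₂ + c₂ + d₂) + (aₘ + dₘ)
    regroup = solve-∀
    regroup′ : ∀ b₁ z b₂ aₘ dₘ → (b₁ + z) + b₂ + (aₘ + dₘ) ≡ b₁ + ((aₘ + (dₘ + z)) + b₂)
    regroup′ = solve-∀

  swapAbove-suc : SwapAbove (suc m)
  swapAbove-suc h₁ h₂ t L =
    when-combine₃ t (D 2 (true ∷ false ∷ h₂)) (D 1 (true ∷ h₂)) (D 1 (false ∷ h₂))
                    (U 2 (true ∷ false ∷ h₂)) (U 1 (true ∷ h₂)) (U 1 (false ∷ h₂))
                    (descentsAbove h₁ h₂ L) (ascentsAbove h₁ h₂ L)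
    where
    D U : ℕ → List Bool → ℕ
    D k r = descents (k + m) (h₁ ++ r) L
    U k r = ascents (k + m) (h₁ ++ r) L

  swapBelow-suc : SwapBelow (suc m)
  swapBelow-suc H t l₁ l₂ =
    when-combine₃₂ t (D 2 (true ∷ false ∷ l₂)) (D 1 (true ∷ l₂)) (D 1 (false ∷ l₂))
                     (U 2 (true ∷ false ∷ l₂)) (U 1 (true ∷ l₂)) (U 1 (false ∷ l₂))
                     (D 2 (false ∷ true ∷ l₂)) (D 0 l₂) (U 2 (false ∷ true ∷ l₂)) (U 0 l₂)
                     (descentsBelow H l₁ l₂) (ascentsBelow H l₁ l₂)
    where
    D U : ℕ → List Bool → ℕ
    D k r = descents (k + m) H (l₁ ++ r)
    U k r = ascents (k + m) H (l₁ ++ r)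

swaps : ∀ n → SwapAbove n × SwapBelow n
swaps zero    = swapAbove-zero , swapBelow-zero
swaps (suc n) = SwapStep.swapAbove-suc {n} ih↑ ih↓ , SwapStep.swapBelow-suc {n} ih↑ ih↓
  where
  ih↑ : SwapAbove n
  ih↑ = proj₁ (swaps n)
  ih↓ : SwapBelow n
  ih↓ = proj₂ (swaps n)

swapAbove : ∀ n → SwapAbove n
swapAbove n = proj₁ (swaps n)


-- The letters 1, …, 2n

dbl : ℕ → ℕ
dbl zero    = 0
dbl (suc n) = suc (suc (dbl n))

2*≡dbl : ∀ n → 2 * n ≡ dbl n
2*≡dbl zero    = refl
2*≡dbl (suc n) = cong suc (trans (+-suc n (n + 0)) (cong suc (2*≡dbl n)))

dbl-+ : ∀ a b → dbl (a + b) ≡ dbl a + dbl b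
dbl-+ zero    b = refl
dbl-+ (suc a) b = cong (suc ∘ suc) (dbl-+ a b)

odd?-dbl+ : ∀ i k → odd? (dbl i + k) ≡ odd? k
odd?-dbl+ zero    k = refl
odd?-dbl+ (suc i) k = odd?-dbl+ i k

odd?-dbl : ∀ i → odd? (dbl i) ≡ false
odd?-dbl zero    = refl
odd?-dbl (suc i) = odd?-dbl i

odd?-suc-dbl : ∀ i → odd? (suc (dbl i)) ≡ true
odd?-suc-dbl i = trans (odd?-suc (dbl i)) (cong not (odd?-dbl i))

evenOdd : ℕ → List Bool
evenOdd zero    = []
evenOdd (suc i) = false ∷ true ∷ evenOdd i

evenOdd-++ : ∀ i j → evenOdd i ++ evenOdd j ≡ evenOdd (i + j)
evenOdd-++ zero    j = refl
evenOdd-++ (suc i) j = cong (λ w → false ∷ true ∷ w) (evenOdd-++ i j)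

evenOdd-snoc : ∀ i → evenOdd i ++ false ∷ true ∷ [] ≡ evenOdd (suc i)
evenOdd-snoc i = trans (evenOdd-++ i 1) (cong evenOdd (+-comm i 1))

above : ℕ → ℕ → List ℕ
above k d = applyDownFrom (λ i → suc (i + k)) d

down-++ : ∀ d k → down (d + k) ≡ above k d ++ down k
down-++ zero    k = refl
down-++ (suc d) k = cong (suc (d + k) ∷_) (down-++ d k)

above-snoc : ∀ k d → above k (suc d) ≡ above (suc k) d ++ suc k ∷ []
above-snoc k zero    = refl
above-snoc k (suc d) = cong₂ _∷_ (cong suc (sym (+-suc d k))) (above-snoc k d)

parities-above : ∀ k i → odd? k ≡ false → map odd? (above k (dbl i)) ≡ evenOdd i
parities-above k zero    _      = refl
parities-above k (suc i) k-even = cong₂ _∷_ (trans (odd?-dbl+ i k) k-even)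
  (cong₂ _∷_ (trans (odd?-suc (dbl i + k)) (cong not (trans (odd?-dbl+ i k) k-even))) (parities-above k i k-even))

parities-above-odd : ∀ k i → odd? k ≡ true → map odd? (above k (suc (dbl i))) ≡ evenOdd i ++ false ∷ []
parities-above-odd k i k-odd = begin
  map odd? (above k (suc (dbl i)))
    ≡⟨ cong (map odd?) (above-snoc k (dbl i)) ⟩
  map odd? (above (suc k) (dbl i) ++ suc k ∷ [])
    ≡⟨ map-++ odd? (above (suc k) (dbl i)) (suc k ∷ []) ⟩
  map odd? (above (suc k) (dbl i)) ++ odd? (suc k) ∷ []
    ≡⟨ cong₂ (λ H b → H ++ b ∷ []) (parities-above (suc k) i suc-k-even) suc-k-even ⟩
  evenOdd i ++ false ∷ [] ∎
  where
  suc-k-even : odd? (suc k) ≡ false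
  suc-k-even = trans (odd?-suc k) (cong not k-odd)

parities-down : ∀ i → map odd? (down (dbl i)) ≡ evenOdd i
parities-down zero    = refl
parities-down (suc i) = cong₂ _∷_ (odd?-dbl i) (cong₂ _∷_ (odd?-suc-dbl i) (parities-down i))

parities-down-odd : ∀ i → map odd? (down (suc (dbl i))) ≡ true ∷ evenOdd i
parities-down-odd i = cong₂ _∷_ (odd?-suc-dbl i) (parities-down i)

GIk≡ways : ∀ {m} d k → d + k ≡ m →
  GIk (suc m) (suc k) ≡ ways m (map odd? (above (suc k) d)) (odd? (suc k)) (map odd? (down k))
GIk≡ways d k refl = trans (GIk≡countFrom (d + k) (above (suc k) d) (suc k) (down k) split)
                          (parityTransfer (d + k) (above (suc k) d) (suc k) (down k) len desc)
  where
  split : above (suc k) d ++ suc k ∷ down k ≡ down (suc (d + k))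
  split = trans (sym (down-++ d (suc k))) (cong down (+-suc d k))
  len : length (above (suc k) d ++ down k) ≡ d + k
  len = trans (length-++ (above (suc k) d)) (cong₂ _+_ (length-applyDownFrom _ d) (length-applyDownFrom suc k))
  desc : Descending (above (suc k) d ++ suc k ∷ down k)
  desc = subst Descending (sym split) (down-descending (suc (d + k)))

GIk-1≡ways : ∀ n → GIk (dbl (suc n)) 1 ≡ ways (suc (dbl n)) (evenOdd n ++ false ∷ []) true []
GIk-1≡ways n = trans (GIk≡ways (suc (dbl n)) 0 (+-identityʳ _))
                (cong (λ H → ways (suc (dbl n)) H true []) (parities-above-odd 1 n refl))

GIk-2≡ways : ∀ n → GIk (dbl (suc n)) 2 ≡ ways (suc (dbl n)) (evenOdd n) false (true ∷ [])
GIk-2≡ways n = trans (GIk≡ways (dbl n) 1 (+-comm (dbl n) 1))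
                (cong (λ H → ways (suc (dbl n)) H false (true ∷ [])) (parities-above 2 n refl))

GIk-3≡ways : ∀ n → GIk (dbl (2 + n)) 3 ≡ ways (3 + dbl n) (evenOdd n ++ false ∷ []) true (false ∷ true ∷ [])
GIk-3≡ways n = trans (GIk≡ways (suc (dbl n)) 2 (cong suc (+-comm (dbl n) 2)))
                (cong (λ H → ways (3 + dbl n) H true (false ∷ true ∷ [])) (parities-above-odd 3 n refl))

GIk-even≡ways : ∀ i j →
  GIk (dbl (suc (i + j))) (dbl (suc j)) ≡ ways (suc (dbl (i + j))) (evenOdd i) false (true ∷ evenOdd j)
GIk-even≡ways i j = trans (GIk≡ways (dbl i) (suc (dbl j)) (trans (+-suc (dbl i) (dbl j)) (cong suc (sym (dbl-+ i j)))))
                     (ways-cong (suc (dbl (i + j))) (parities-above (dbl (suc j)) i (odd?-dbl (suc j)))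
                                (odd?-dbl j) (parities-down-odd j))

GIk-penultimate≡ways : ∀ n → GIk (dbl (suc n)) (suc (dbl n)) ≡ ways (suc (dbl n)) (false ∷ []) true (evenOdd n)
GIk-penultimate≡ways n = trans (GIk≡ways 1 (dbl n) refl)
  (ways-cong (suc (dbl n)) (cong (_∷ []) (odd?-dbl n)) (odd?-suc-dbl n) (parities-down n))

GIk-last≡ways : ∀ n → GIk (dbl (suc n)) (dbl (suc n)) ≡ ways (suc (dbl n)) [] false (true ∷ evenOdd n)
GIk-last≡ways n = trans (GIk≡ways 0 (suc (dbl n)) refl)
  (ways-cong (suc (dbl n)) {H = []} refl (odd?-dbl n) (parities-down-odd n))

sum1to-GIk≡allWays : ∀ n → sum1to (dbl (suc n)) (GIk (dbl (suc n))) ≡ allWays (suc (dbl n)) (evenOdd (suc n))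
sum1to-GIk≡allWays n = begin
  sum1to (dbl (suc n)) (GIk (dbl (suc n)))
    ≡⟨ sum1to≡sumSplits-countFrom (suc (dbl n)) ⟩
  sumSplits (λ p j q → countFrom j (p ++ q)) (down (dbl (suc n)))
    ≡⟨ sumSplits-countFrom≡allWays (suc (dbl n)) ⟩
  allWays (suc (dbl n)) (map odd? (down (dbl (suc n))))
    ≡⟨ cong (allWays (suc (dbl n))) (parities-down (suc n)) ⟩
  allWays (suc (dbl n)) (evenOdd (suc n)) ∎

GI≡allWays : ∀ n → GI (dbl (suc n)) ≡ allWays (suc (dbl n)) (evenOdd (suc n))
GI≡allWays n = begin
  GI (dbl (suc n))
    ≡⟨ GI≡sumSplits-countFrom (suc (dbl n)) ⟩
  sumSplits (λ p j q → countFrom j (p ++ q)) (down (dbl (suc n)))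
    ≡⟨ sumSplits-countFrom≡allWays (suc (dbl n)) ⟩
  allWays (suc (dbl n)) (map odd? (down (dbl (suc n))))
    ≡⟨ cong (allWays (suc (dbl n))) (parities-down (suc n)) ⟩
  allWays (suc (dbl n)) (evenOdd (suc n)) ∎


-- The Seidel recurrence

sumAntidiagonal : ℕ → (ℕ → ℕ → ℕ) → ℕ
sumAntidiagonal zero    h = 0
sumAntidiagonal (suc i) h = h 0 i + sumAntidiagonal i (λ p q → h (suc p) q)

sumAntidiagonal-cong : ∀ i {h h′ : ℕ → ℕ → ℕ} → (∀ p q → suc (p + q) ≡ i → h p q ≡ h′ p q) →
                       sumAntidiagonal i h ≡ sumAntidiagonal i h′
sumAntidiagonal-cong zero    eq = refl
sumAntidiagonal-cong (suc i) eq =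
  cong₂ _+_ (eq 0 i refl) (sumAntidiagonal-cong i (λ p q e → eq (suc p) q (cong suc e)))

sumAntidiagonal-suc : ∀ i h → sumAntidiagonal (suc i) h ≡ sumAntidiagonal i (λ p q → h p (suc q)) + h i 0
sumAntidiagonal-suc zero    h = +-comm (h 0 0) 0
sumAntidiagonal-suc (suc i) h =
  trans (cong (h 0 (suc i) +_) (sumAntidiagonal-suc i (λ p q → h (suc p) q))) (sym (+-assoc (h 0 (suc i)) _ _))

antidiagonal-shift : ∀ p q j {i} → suc (p + q) ≡ i → p + (q + suc j) ≡ i + j
antidiagonal-shift p q j refl = trans (cong (p +_) (+-suc q j)) (trans (+-suc p (q + j)) (cong suc (sym (+-assoc p q j))))

SeidelRecurrence : (ℕ → ℕ → ℕ) → Set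
SeidelRecurrence f = (∀ i → f (suc i) 0 ≡ sumAntidiagonal (suc i) f)
                   × (∀ i j → f i (suc j) ≡ f (suc i) j + f i j + sumAntidiagonal i (λ p q → f p (q + suc j)))

seidelRecurrence-unique : ∀ {f g} → SeidelRecurrence f → SeidelRecurrence g → f 0 0 ≡ g 0 0 →
                          ∀ i j → f i j ≡ g i j
seidelRecurrence-unique {f} {g} (f-first , f-step) (g-first , g-step) base i j = bySum (i + j) i j refl
  where
  bySum : ∀ s i j → i + j ≡ s → f i j ≡ g i j
  bySum zero    zero zero refl = base
  bySum (suc s) i    j    i+j≡ = byColumn j i i+j≡
    where
    smaller : ∀ i j → i + j ≡ s → f i j ≡ g i j
    smaller = bySum s
    byColumn : ∀ j i → i + j ≡ suc s → f i j ≡ g i j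
    byColumn zero    (suc i) e = begin
      f (suc i) 0                ≡⟨ f-first i ⟩
      sumAntidiagonal (suc i) f  ≡⟨ sumAntidiagonal-cong (suc i) (λ p q e′ → smaller p q (trans (suc-injective e′) i≡s)) ⟩
      sumAntidiagonal (suc i) g  ≡⟨ g-first i ⟨
      g (suc i) 0                ∎
      where
      i≡s : i ≡ s
      i≡s = trans (sym (+-identityʳ i)) (suc-injective e)
    byColumn (suc j) i e = begin
      f i (suc j)
        ≡⟨ f-step i j ⟩
      f (suc i) j + f i j + sumAntidiagonal i (λ p q → f p (q + suc j))
        ≡⟨ cong₂ _+_ (cong₂ _+_ (byColumn j (suc i) (trans (sym (+-suc i j)) e)) (smaller i j i+j≡s))
                     (sumAntidiagonal-cong i (λ p q e′ → smaller p (q + suc j) (trans (antidiagonal-shift p q j e′) i+j≡s))) ⟩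
      g (suc i) j + g i j + sumAntidiagonal i (λ p q → g p (q + suc j))
        ≡⟨ g-step i j ⟨
      g i (suc j) ∎
      where
      i+j≡s : i + j ≡ s
      i+j≡s = suc-injective (trans (sym (+-suc i j)) e)

seidel : ℕ → ℕ → ℕ
seidel i j = E (suc (i + j)) (suc i)

seidel-unfold : ∀ i j → seidel i j ≡ EAcc (suc (i + j)) (suc i) (suc j)
seidel-unfold i j = trans (if-cong (<ᵇ-true (s≤s (m≤m+n i j))))
                          (cong (EAcc (suc (i + j)) (suc i)) (trans (cong (_∸ i) (sym (+-suc i j))) (m+n∸m≡n i (suc j))))

OAcc≡sumAntidiagonal : ∀ r i → OAcc r i ≡ sumAntidiagonal i (λ p _ → E r (suc p))
OAcc≡sumAntidiagonal r zero    = refl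
OAcc≡sumAntidiagonal r (suc i) = begin
  E r (suc i) + OAcc r i                                    ≡⟨ cong (E r (suc i) +_) (OAcc≡sumAntidiagonal r i) ⟩
  E r (suc i) + sumAntidiagonal i (λ p _ → E r (suc p))     ≡⟨ +-comm (E r (suc i)) _ ⟩
  sumAntidiagonal i (λ p _ → E r (suc p)) + E r (suc i)     ≡⟨ sumAntidiagonal-suc i (λ p _ → E r (suc p)) ⟨
  sumAntidiagonal (suc i) (λ p _ → E r (suc p))             ∎

seidel-first : ∀ i → seidel (suc i) 0 ≡ sumAntidiagonal (suc i) seidel
seidel-first i = begin
  seidel (suc i) 0
    ≡⟨ seidel-unfold (suc i) 0 ⟩
  O (suc (i + 0)) (suc (suc i)) + 0
    ≡⟨ +-identityʳ _ ⟩
  O (suc (i + 0)) (suc (suc i))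
    ≡⟨ if-cong (<ᵇ-true (s≤s (m≤m+n i 0))) ⟩
  E (suc (i + 0)) (suc (suc i)) + OAcc (suc (i + 0)) (suc i)
    ≡⟨ cong (_+ OAcc (suc (i + 0)) (suc i)) (if-cong (≤⇒<ᵇ-false (≤-reflexive (+-identityʳ i)))) ⟩
  OAcc (suc (i + 0)) (suc i)
    ≡⟨ OAcc≡sumAntidiagonal (suc (i + 0)) (suc i) ⟩
  sumAntidiagonal (suc i) (λ p _ → E (suc (i + 0)) (suc p))
    ≡⟨ sumAntidiagonal-cong (suc i) (λ p q e → cong (λ r → E (suc r) (suc p)) (trans (+-identityʳ i) (sym (suc-injective e)))) ⟩
  sumAntidiagonal (suc i) seidel ∎

seidel-step : ∀ i j →
  seidel i (suc j) ≡ seidel (suc i) j + seidel i j + sumAntidiagonal i (λ p q → seidel p (q + suc j))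
seidel-step i j = begin
  seidel i (suc j)
    ≡⟨ seidel-unfold i (suc j) ⟩
  EAcc (suc (i + suc j)) (suc i) (suc (suc j))
    ≡⟨ cong (λ r → EAcc (suc r) (suc i) (suc (suc j))) (+-suc i j) ⟩
  O (suc (i + j)) (suc i) + EAcc (suc (suc (i + j))) (suc (suc i)) (suc j)
    ≡⟨ cong (O (suc (i + j)) (suc i) +_) (seidel-unfold (suc i) j) ⟨
  O (suc (i + j)) (suc i) + seidel (suc i) j
    ≡⟨ cong (_+ seidel (suc i) j) (if-cong (<ᵇ-true (s≤s (≤-trans (m≤m+n i j) (n≤1+n _))))) ⟩
  (seidel i j + OAcc (suc (i + j)) i) + seidel (suc i) j
    ≡⟨ cong (λ o → (seidel i j + o) + seidel (suc i) j) (OAcc≡sumAntidiagonal (suc (i + j)) i) ⟩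
  (seidel i j + sumAntidiagonal i (λ p _ → E (suc (i + j)) (suc p))) + seidel (suc i) j
    ≡⟨ cong (λ σ → (seidel i j + σ) + seidel (suc i) j)
            (sumAntidiagonal-cong i (λ p q e → cong (λ r → E (suc r) (suc p)) (sym (antidiagonal-shift p q j e)))) ⟩
  (seidel i j + σ) + seidel (suc i) j
    ≡⟨ rotate (seidel i j) σ (seidel (suc i) j) ⟩
  seidel (suc i) j + seidel i j + σ ∎
  where
  σ : ℕ
  σ = sumAntidiagonal i (λ p q → seidel p (q + suc j))
  rotate : ∀ a b c → (a + b) + c ≡ c + a + b
  rotate = solve-∀

seidel-recurrence : SeidelRecurrence seidel
seidel-recurrence = seidel-first , seidel-step

S-even : ∀ n k → S (2 * n) k ≡ E n k
S-even n k = trans (if-cong (cong (_≡ᵇ 0) (trans (cong (_% 2) (*-comm 2 n)) (m*n%n≡0 n 2))))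
                   (cong (λ r → E r k) (trans (cong (_/ 2) (*-comm 2 n)) (m*n/n≡m n 2)))

sumSplits-evenOdd : ∀ i (F : List Bool → Bool → List Bool → ℕ) →
  sumSplits (λ a x b → when (not x) (F a x b)) (evenOdd i)
  ≡ sumAntidiagonal i (λ p q → F (evenOdd p) false (true ∷ evenOdd q))
sumSplits-evenOdd zero    F = refl
sumSplits-evenOdd (suc i) F =
  cong (F [] false (true ∷ evenOdd i) +_) (sumSplits-evenOdd i (λ a x b → F (false ∷ true ∷ a) x b))

ways-evenOdd-oddBottom : ∀ n i →
  ways (2 + n) (evenOdd i) false (true ∷ [])
  ≡ sumAntidiagonal i (λ p q → ways n (evenOdd p) false (true ∷ evenOdd q))
ways-evenOdd-oddBottom n i = begin
  ways (2 + n) (evenOdd i) false (true ∷ [])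
    ≡⟨ ways-evenStart-oddBelow (suc n) (evenOdd i) [] ⟨
  ascents n (evenOdd i) []
    ≡⟨ sumSplits-evenOdd i (λ a x b → ways n a x (b ++ [])) ⟩
  sumAntidiagonal i (λ p q → ways n (evenOdd p) false ((true ∷ evenOdd q) ++ []))
    ≡⟨ sumAntidiagonal-cong i (λ p q _ → cong (ways n (evenOdd p) false) (++-identityʳ _)) ⟩
  sumAntidiagonal i (λ p q → ways n (evenOdd p) false (true ∷ evenOdd q)) ∎

ways-evenOdd-step : ∀ n i j →
  ways (3 + n) (evenOdd i) false (true ∷ evenOdd (suc j))
  ≡ ways (3 + n) (evenOdd (suc i)) false (true ∷ evenOdd j) + ways (suc n) (evenOdd i) false (true ∷ evenOdd j)
    + sumAntidiagonal i (λ p q → ways (suc n) (evenOdd p) false (true ∷ evenOdd (q + suc j)))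
ways-evenOdd-step n i j = begin
  descents (2 + n) K (true ∷ false ∷ true ∷ L) + 0
    ≡⟨ cong (_+ 0) (descents-∷ (2 + n) K true (false ∷ true ∷ L)) ⟩
  ((descents (suc n) K (false ∷ true ∷ L) + U) + (W + σTF)) + 0
    ≡⟨ cong (λ d → ((d + U) + (W + σTF)) + 0) (descents-∷ (suc n) K false (true ∷ L)) ⟩
  (((G + σF) + U) + (W + σTF)) + 0
    ≡⟨ cong₂ (λ u w → (((G + σF) + u) + (w + σTF)) + 0) lowerAscents oddAbove ⟩
  (((G + σF) + Σ) + ((σT + 0) + σTF)) + 0
    ≡⟨ regroup G σF Σ σT σTF ⟩
  ((σTF + σT + σF) + 0 + G) + Σ
    ≡⟨ cong (λ x → ((x + 0) + G) + Σ) swapped ⟩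
  (σFT + 0 + G) + Σ
    ≡⟨ cong (λ x → ((x + 0) + G) + Σ) (sumSplits-cong (true ∷ L) (λ a y b _ → cong (λ K′ → ways (2 + n) K′ y b) (topPair a))) ⟩
  ways (3 + n) (evenOdd (suc i)) false (true ∷ L) + G + Σ ∎
  where
  K L : List Bool
  K = evenOdd i
  L = evenOdd j
  wTF wFT wT wF : List Bool → Bool → List Bool → ℕ
  wTF a y b = ways (2 + n) (K ++ true ∷ false ∷ a) y b
  wFT a y b = ways (2 + n) (K ++ false ∷ true ∷ a) y b
  wT  a y b = ways (suc n) (K ++ true ∷ a) y b
  wF  a y b = ways (suc n) (K ++ false ∷ a) y b
  G U W σTF σFT σT σF Σ : ℕ
  G   = ways (suc n) K false (true ∷ L)
  U   = ascents (suc n) K (false ∷ true ∷ L)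
  W   = ways (2 + n) (K ++ true ∷ []) false (true ∷ L)
  σTF = sumSplits wTF (true ∷ L)
  σFT = sumSplits wFT (true ∷ L)
  σT  = sumSplits wT (true ∷ L)
  σF  = sumSplits wF (true ∷ L)
  Σ   = sumAntidiagonal i (λ p q → ways (suc n) (evenOdd p) false (true ∷ evenOdd (q + suc j)))
  lowerAscents : U ≡ Σ
  lowerAscents = trans (sumSplits-evenOdd i (λ a x b → ways (suc n) a x (b ++ false ∷ true ∷ L)))
    (sumAntidiagonal-cong i (λ p q _ → cong (λ R → ways (suc n) (evenOdd p) false (true ∷ R)) (evenOdd-++ q (suc j))))
  oddAbove : W ≡ σT + 0
  oddAbove = cong (_+ 0) (descents-snoc (suc n) K true (true ∷ L))
  swapped : σTF + σT + σF ≡ σFT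
  swapped = trans (sym (sumSplits-+₃ wTF wT wF (true ∷ L))) (sumSplits-cong (true ∷ L) (λ a y b _ → swapAbove n K a y b))
  topPair : ∀ a → K ++ false ∷ true ∷ a ≡ evenOdd (suc i) ++ a
  topPair a = trans (sym (++-assoc K (false ∷ true ∷ []) a)) (cong (_++ a) (evenOdd-snoc i))
  regroup : ∀ g f s t u → (((g + f) + s) + ((t + 0) + u)) + 0 ≡ ((u + t + f) + 0 + g) + s
  regroup = solve-∀

-- evenStart i j = G_{2(i+j+1), 2(j+1)}
evenStart : ℕ → ℕ → ℕ
evenStart i j = ways (suc (dbl (i + j))) (evenOdd i) false (true ∷ evenOdd j)

evenStart-recurrence : SeidelRecurrence evenStart
evenStart-recurrence = first , step
  where
  first : ∀ i → evenStart (suc i) 0 ≡ sumAntidiagonal (suc i) evenStart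
  first i = trans (ways-evenOdd-oddBottom (suc (dbl (i + 0))) (suc i))
    (sumAntidiagonal-cong (suc i) (λ p q e → cong (λ r → ways (suc (dbl r)) (evenOdd p) false (true ∷ evenOdd q))
                                                    (trans (+-identityʳ i) (sym (suc-injective e)))))
  step : ∀ i j →
    evenStart i (suc j) ≡ evenStart (suc i) j + evenStart i j + sumAntidiagonal i (λ p q → evenStart p (q + suc j))
  step i j = begin
    evenStart i (suc j)
      ≡⟨ cong (λ r → ways (suc (dbl r)) (evenOdd i) false (true ∷ evenOdd (suc j))) (+-suc i j) ⟩
    ways (3 + dbl (i + j)) (evenOdd i) false (true ∷ evenOdd (suc j))
      ≡⟨ ways-evenOdd-step (dbl (i + j)) i j ⟩
    evenStart (suc i) j + evenStart i j
    + sumAntidiagonal i (λ p q → ways (suc (dbl (i + j))) (evenOdd p) false (true ∷ evenOdd (q + suc j)))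
      ≡⟨ cong (evenStart (suc i) j + evenStart i j +_)
              (sumAntidiagonal-cong i (λ p q e → cong (λ r → ways (suc (dbl r)) (evenOdd p) false (true ∷ evenOdd (q + suc j)))
                                                      (sym (antidiagonal-shift p q j e)))) ⟩
    evenStart (suc i) j + evenStart i j + sumAntidiagonal i (λ p q → evenStart p (q + suc j)) ∎

evenStart≡seidel : ∀ i j → evenStart i j ≡ seidel i j
evenStart≡seidel = seidelRecurrence-unique evenStart-recurrence seidel-recurrence refl


GIk-1≡GIk-2 : ∀ n → 1 ≤ n → GIk (2 * n) 1 ≡ GIk (2 * n) 2
GIk-1≡GIk-2 (suc n) _ = subst (λ m → GIk m 1 ≡ GIk m 2) (sym (2*≡dbl (suc n)))
  (trans (GIk-1≡ways n) (trans (ways-swapBottomPair (dbl n) (evenOdd n)) (sym (GIk-2≡ways n))))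

twice-GIk-penultimate≡sum : ∀ n → 1 ≤ n → 2 * GIk (2 * n) (2 * n ∸ 1) ≡ sum1to (2 * n) (GIk (2 * n))
twice-GIk-penultimate≡sum (suc n) _ =
  subst (λ m → 2 * GIk m (m ∸ 1) ≡ sum1to m (GIk m)) (sym (2*≡dbl (suc n))) (begin
  2 * GIk (dbl (suc n)) (suc (dbl n))            ≡⟨ cong (2 *_) (GIk-penultimate≡ways n) ⟩
  2 * ways (suc (dbl n)) (false ∷ []) true (evenOdd n) ≡⟨ allWays-evenOddTop (dbl n) (evenOdd n) ⟨
  allWays (suc (dbl n)) (evenOdd (suc n))        ≡⟨ sum1to-GIk≡allWays n ⟨
  sum1to (dbl (suc n)) (GIk (dbl (suc n)))       ∎)

GIk-even≡seidel : ∀ i j → GIk (2 * suc (i + j)) (2 * suc j) ≡ S (2 * suc (i + j)) (suc (i + j) + 1 ∸ suc j)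
GIk-even≡seidel i j = begin
  GIk (2 * suc (i + j)) (2 * suc j)          ≡⟨ cong₂ GIk (2*≡dbl (suc (i + j))) (2*≡dbl (suc j)) ⟩
  GIk (dbl (suc (i + j))) (dbl (suc j))      ≡⟨ GIk-even≡ways i j ⟩
  evenStart i j                              ≡⟨ evenStart≡seidel i j ⟩
  seidel i j                                 ≡⟨ S-even (suc (i + j)) (suc i) ⟨
  S (2 * suc (i + j)) (suc i)                ≡⟨ cong (S (2 * suc (i + j))) column ⟨
  S (2 * suc (i + j)) (suc (i + j) + 1 ∸ suc j) ∎
  where
  column : suc (i + j) + 1 ∸ suc j ≡ suc i
  column = trans (cong (_∸ j) (+-comm (i + j) 1)) (m+n∸n≡m (suc i) j)

GIk-even≡S : ∀ n k → 1 ≤ k → k ≤ n → GIk (2 * n) (2 * k) ≡ S (2 * n) (n + 1 ∸ k)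
GIk-even≡S (suc n) (suc j) _ (s≤s j≤n) =
  subst (λ m → GIk (2 * suc m) (2 * suc j) ≡ S (2 * suc m) (suc m + 1 ∸ suc j)) (m∸n+n≡m j≤n)
        (GIk-even≡seidel (n ∸ j) j)

GIk-3≡twice : ∀ n → 2 ≤ n → GIk (2 * n) 3 ≡ 2 * (GIk (2 * n) 1 + GIk (2 * n ∸ 2) 1)
GIk-3≡twice (suc zero)    (s≤s ())
GIk-3≡twice (suc (suc n)) _ =
  subst (λ m → GIk m 3 ≡ 2 * (GIk m 1 + GIk (m ∸ 2) 1)) (sym (2*≡dbl (2 + n))) (begin
  GIk (dbl (2 + n)) 3
    ≡⟨ GIk-3≡ways n ⟩
  ways (3 + dbl n) H true (false ∷ true ∷ [])
    ≡⟨ ways-oddStart-evenOddBottom (dbl n) H ⟩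
  2 * (ways (3 + dbl n) (H ++ true ∷ false ∷ []) true [] + ways (suc (dbl n)) H true [])
    ≡⟨ cong (λ H′ → 2 * (ways (3 + dbl n) H′ true [] + ways (suc (dbl n)) H true [])) shift ⟩
  2 * (ways (3 + dbl n) (evenOdd (suc n) ++ false ∷ []) true [] + ways (suc (dbl n)) H true [])
    ≡⟨ cong₂ (λ x y → 2 * (x + y)) (GIk-1≡ways (suc n)) (GIk-1≡ways n) ⟨
  2 * (GIk (dbl (2 + n)) 1 + GIk (dbl (suc n)) 1) ∎)
  where
  H : List Bool
  H = evenOdd n ++ false ∷ []
  shift : H ++ true ∷ false ∷ [] ≡ evenOdd (suc n) ++ false ∷ []
  shift = begin
    (evenOdd n ++ false ∷ []) ++ true ∷ false ∷ [] ≡⟨ ++-assoc (evenOdd n) (false ∷ []) (true ∷ false ∷ []) ⟩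
    evenOdd n ++ false ∷ true ∷ false ∷ []         ≡⟨ ++-assoc (evenOdd n) (false ∷ true ∷ []) (false ∷ []) ⟨
    (evenOdd n ++ false ∷ true ∷ []) ++ false ∷ [] ≡⟨ cong (_++ false ∷ []) (evenOdd-snoc n) ⟩
    evenOdd (suc n) ++ false ∷ []                  ∎

GIk-last≡sum : ∀ n → 2 ≤ n → GIk (2 * n) (2 * n) ≡ sum1to (2 * n ∸ 2) (GIk (2 * n ∸ 2))
GIk-last≡sum (suc zero)    (s≤s ())
GIk-last≡sum (suc (suc n)) _ =
  subst (λ m → GIk m m ≡ sum1to (m ∸ 2) (GIk (m ∸ 2))) (sym (2*≡dbl (2 + n))) (begin
  GIk (dbl (2 + n)) (dbl (2 + n))                          ≡⟨ GIk-last≡ways (suc n) ⟩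
  ways (2 + suc (dbl n)) [] false (true ∷ evenOdd (suc n)) ≡⟨ ways-evenTopStart-allWays (suc (dbl n)) (evenOdd (suc n)) ⟩
  allWays (suc (dbl n)) (evenOdd (suc n))                  ≡⟨ sum1to-GIk≡allWays n ⟨
  sum1to (dbl (suc n)) (GIk (dbl (suc n)))                 ∎)

sum-GIk≡GI : ∀ n → 2 ≤ n → sum1to (2 * n ∸ 2) (GIk (2 * n ∸ 2)) ≡ GI (2 * n ∸ 2)
sum-GIk≡GI (suc zero)    (s≤s ())
sum-GIk≡GI (suc (suc n)) _ = subst (λ m → sum1to (m ∸ 2) (GIk (m ∸ 2)) ≡ GI (m ∸ 2)) (sym (2*≡dbl (2 + n)))
  (trans (sum1to-GIk≡allWays n) (sym (GI≡allWays n)))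

theorem1p5 :
    ((n : ℕ) → 1 ≤ n →
        (GIk (2 * n) 1 ≡ GIk (2 * n) 2)
      × (2 * GIk (2 * n) (2 * n ∸ 1) ≡ sum1to (2 * n) (GIk (2 * n)))
      × ((k : ℕ) → 1 ≤ k → k ≤ n → GIk (2 * n) (2 * k) ≡ S (2 * n) (n + 1 ∸ k)))
    × ((n : ℕ) → 2 ≤ n →
        (GIk (2 * n) 3 ≡ 2 * (GIk (2 * n) 1 + GIk (2 * n ∸ 2) 1))
      × (GIk (2 * n) (2 * n) ≡ sum1to (2 * n ∸ 2) (GIk (2 * n ∸ 2)))
      × (sum1to (2 * n ∸ 2) (GIk (2 * n ∸ 2)) ≡ GI (2 * n ∸ 2)))
theorem1p5 =
  (λ n 1≤n → GIk-1≡GIk-2 n 1≤n , twice-GIk-penultimate≡sum n 1≤n , GIk-even≡S n) ,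
  (λ n 2≤n → GIk-3≡twice n 2≤n , GIk-last≡sum n 2≤n , sum-GIk≡GI n 2≤n)
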